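{- Let $n\ge 1$ and let $S\subseteq[n]$ with $n\in S$. Write the indicator vector of $S$ as $\mathbb{I}(S)=(0^{r_1},1^{r_2},0^{r_3},1^{r_4},\ldots,0^{r_{2m-1}},1^{r_{2m}})$ with $r_1\ge 0$ and $r_i>0$ for $2\le i\le 2m$. For $1\le i\le m$ put $$u_i=\min\Big\{r_{2i-1},\sum_{j=i+1}^m r_{2j}\Big\},\qquad v_i=\min\Big\{r_{2i},\sum_{j=1}^{i-1} r_{2j-1}\Big\}$$ (empty sums equal $0$). Then for every positive integer $t$, $$i(\mathrm{SM}_n(S),t)=\sum_{(c_1,\ldots,c_m)}\prod_{j=1}^m F(r_{2j-1},r_{2j},c_j,t),$$ where the sum runs over all integer vectors $(c_1,\ldots,c_m)$ with $c_1+\cdots+c_m=0$ and, for every $1\le j\le m$, $-tv_j\le c_j\le tu_j$ and $c_1+\cdots+c_j\ge 0$.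
   Context: For $S\subseteq[n]$, the Schubert matroid $\mathrm{SM}_n(S)$ is the matroid on ground set $[n]$ whose bases are the sets $T\subseteq[n]$ with $|T|=|S|$ such that, for each $i$, the $i$-th smallest element of $T$ is at most the $i$-th smallest element of $S$. The indicator vector $\mathbb{I}(S)=(i_1,\ldots,i_n)$ has $i_j=1$ if $j\in S$ and $0$ otherwise; $0^{r}$ (resp. $1^r$) denotes $r$ consecutive zeros (resp. ones). For a matroid $M$ on $[n]$ with base set $\mathcal B$, its matroid polytope is $\mathcal P(M)=\mathrm{conv}\{e_B: B\in\mathcal B\}\subseteq\mathbb R^n$ where $e_B=\sum_{b\in B}e_b$, and $i(M,t)=|t\mathcal P(M)\cap\mathbb Z^n|$ is the number of lattice points in the $t$-th dilation (the Ehrhart polynomial). For integers $a,b,t\ge 0$ and $c\in\mathbb Z$, $$F(a,b,c,t)=\sum_{j=0}^{a+b}(-1)^j\binom{a+b}{j}\binom{(t+1)(b-j)+a+c-1}{a+b-1},$$ with the conventions $\binom00=1$ and $\binom NK=0$ whenever $K<0$ or $N<K$. -}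

module Defs where

open import Data.Bool using (Bool; true; false; if_then_else_; _∧_)
open import Data.Nat as ℕ using (ℕ; zero; suc)
open import Data.Nat.Combinatorics using (_C_)
open import Data.Integer as ℤ using (ℤ; +_; -[1+_])
open import Data.Rational as ℚ using (ℚ)
open import Data.Fin using (Fin; toℕ)
open import Data.Fin.Subset using (Subset)
open import Data.Vec using (Vec; lookup; toList)
import Data.Vec
open import Data.List using (List; []; _∷_; [_]; map; concat; concatMap; length; replicate; _++_; upTo; foldr; filterᵇ; zip)
open import Data.List.Relation.Binary.Pointwise using (Pointwise)
open import Data.List.Relation.Unary.All using (All)
open import Data.List.Relation.Unary.Unique.Propositional using (Unique)
open import Data.List.Membership.Propositional using (_∈_)
open import Data.Fin.Base using () renaming (_<_ to _<ᶠ_)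
open import Data.List using (allFin)
open import Data.Product using (_×_; _,_; proj₁; proj₂; ∃)
open import Relation.Binary.PropositionalEquality using (_≡_)
open import Relation.Nullary.Decidable using (⌊_⌋)

-- Subsets of [n] are 'Subset n' (= Vec Bool n); position i : Fin n
-- stands for the element toℕ i + 1 of [n].

elems : ∀ {n} → Subset n → List ℕ
elems Data.Vec.[] = []
elems (true  Data.Vec.∷ s) = 1 ∷ map suc (elems s)
elems (false Data.Vec.∷ s) = map suc (elems s)

IsSMBasis : ∀ {n} → Subset n → Subset n → Set
IsSMBasis S T = (length (elems T) ≡ length (elems S))
              × Pointwise ℕ._≤_ (elems T) (elems S)

ℤ→ℚ : ℤ → ℚ
ℤ→ℚ z = z ℚ./ 1

ℕ→ℚ : ℕ → ℚ
ℕ→ℚ k = ℤ→ℚ (+ k)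

sumℚ : List ℚ → ℚ
sumℚ = foldr ℚ._+_ ℚ.0ℚ

-- x ∈ t · conv{ e_B : B basis }  (x an integer point).  A convex
-- combination is a finite list of pairs (λ_B , B) with λ_B ≥ 0, B a
-- basis, Σ λ_B = 1, and x = t · Σ λ_B e_B coordinatewise.
InDilation : ∀ {n} → (Subset n → Set) → ℕ → Vec ℤ n → Set
InDilation {n} IsBasis t x =
  ∃ λ (cs : List (ℚ × Subset n)) →
      All (λ p → IsBasis (proj₂ p)) cs
    × All (λ p → ℚ.0ℚ ℚ.≤ proj₁ p) cs
    × sumℚ (map proj₁ cs) ≡ ℚ.1ℚ
    × (∀ (i : Fin n) →
         ℤ→ℚ (lookup x i)
           ≡ ℕ→ℚ t ℚ.* sumℚ (map (λ p → if lookup (proj₂ p) i then proj₁ p else ℚ.0ℚ) cs))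

-- i(M,t) = N : the lattice points of tP(M) form a finite set with N elements
EhrhartValue : ∀ {n} → (Subset n → Set) → ℕ → ℤ → Set
EhrhartValue {n} IsBasis t N =
  ∃ λ (xs : List (Vec ℤ n)) →
      Unique xs
    × All (InDilation IsBasis t) xs
    × (∀ x → InDilation IsBasis t x → x ∈ xs)
    × (+ length xs ≡ N)

-- binomial coefficient with integer arguments: 0 if K < 0 or N < K
binomℤ : ℤ → ℤ → ℤ
binomℤ (+ n) (+ k) = + (n C k)   -- n C k = 0 when n < k
binomℤ (+ n) -[1+ k ] = + 0
binomℤ -[1+ n ] _ = + 0

sgn : ℕ → ℤ
sgn zero = + 1
sgn (suc j) = ℤ.- sgn j

sumℤ : List ℤ → ℤ
sumℤ = foldr ℤ._+_ (+ 0)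

prodℤ : List ℤ → ℤ
prodℤ = foldr ℤ._*_ (+ 1)

F : ℕ → ℕ → ℤ → ℕ → ℤ
F a b c t = sumℤ (map term (upTo (suc (a ℕ.+ b))))
  where
  term : ℕ → ℤ
  term j = sgn j ℤ.* (+ ((a ℕ.+ b) C j)) ℤ.*
           binomℤ ((+ (suc t)) ℤ.* (+ b ℤ.- + j) ℤ.+ + a ℤ.+ c ℤ.- + 1)
                  (+ (a ℕ.+ b) ℤ.- + 1)

sumFinWhere : ∀ {m} → (Fin m → Bool) → (Fin m → ℕ) → ℕ
sumFinWhere P f = foldr ℕ._+_ 0 (map f (filterᵇ P (allFin _)))

intRange : ℤ → ℤ → List ℤ
intRange lo hi =
  if lo ℤ.≤ᵇ hi then map (λ k → lo ℤ.+ + k) (upTo (suc ℤ.∣ hi ℤ.- lo ∣)) else []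

box : List (ℤ × ℤ) → List (List ℤ)
box [] = [ [] ]
box ((lo , hi) ∷ rest) = concatMap (λ c → map (c ∷_) (box rest)) (intRange lo hi)

admissible : ℤ → List ℤ → Bool
admissible acc [] = ⌊ acc ℤ.≟ + 0 ⌋
admissible acc (c ∷ cs) = (+ 0 ℤ.≤ᵇ (acc ℤ.+ c)) ∧ admissible (acc ℤ.+ c) cs

-- Data of the run decomposition: a i = r_{2i-1}, b i = r_{2i}
-- (with i : Fin m standing for the index toℕ i + 1).
u : ∀ {m} → (Fin m → ℕ) → (Fin m → ℕ) → Fin m → ℕ
u a b i = a i ℕ.⊓ sumFinWhere (λ j → toℕ i ℕ.<ᵇ toℕ j) b

v : ∀ {m} → (Fin m → ℕ) → (Fin m → ℕ) → Fin m → ℕ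
v a b i = b i ℕ.⊓ sumFinWhere (λ j → toℕ j ℕ.<ᵇ toℕ i) a

RHS : ∀ {m} → (Fin m → ℕ) → (Fin m → ℕ) → ℕ → ℤ
RHS {m} a b t =
  sumℤ (map (λ cs → prodℤ (map (λ p → F (a (proj₁ p)) (b (proj₁ p)) (proj₂ p) t)
                                (zip (allFin m) cs)))
            (filterᵇ (admissible (+ 0)) (box bounds)))
  where
  bounds : List (ℤ × ℤ)
  bounds = map (λ i → (ℤ.- (+ (t ℕ.* v a b i)) , + (t ℕ.* u a b i))) (allFin m)

runWord : ∀ {m} → (Fin m → ℕ) → (Fin m → ℕ) → List Bool
runWord a b = concat (map (λ i → replicate (a i) false ++ replicate (b i) true) (allFin _))

{-# OPTIONS --safe #-}
-- A lattice point of t P(SM_n(S)) is a vector y ∈ [0, t]^n whose prefix sums dominate t times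
-- those of 𝕀(S), with equality at the end (a walk whose slack, the excess of the prefix sums,
-- never becomes negative). Every point of the dilate satisfies these inequalities, since each basis
-- does; conversely such a y is a sum of t bases, split off one at a time by giving the basis the
-- slack ⌈ d / t ⌉. Reading 𝕀(S) block by block 0^{r_{2j-1}} 1^{r_{2j}}, the slack only rises and then
-- falls inside a block, so only its change c_j across the block matters: the admissible vectors c are
-- those with nonnegative prefix sums and total 0, and they automatically satisfy -t v_j ≤ c_j ≤ t u_j.
-- For fixed c the blocks are independent, and block j contributes the compositions of
-- t r_{2j} + c_j into r_{2j-1} + r_{2j} parts in [0, t], counted by inclusion–exclusion as F.
module Submission where

module UniqueLists where

  open import Data.List using (List; []; _∷_; map; concatMap)
  import Data.List.Properties as List
  open import Data.List.Membership.Propositional using (_∈_; find)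
  open import Data.List.Membership.Propositional.Properties using (∈-concatMap⁻; ∈-map⁻)
  open import Data.List.Relation.Unary.Any using (here; there)
  open import Data.List.Relation.Unary.All as All using (_∷_)
  open import Data.List.Relation.Unary.AllPairs using ([]; _∷_)
  open import Data.List.Relation.Unary.Unique.Propositional using (Unique)
  import Data.List.Relation.Unary.Unique.Propositional.Properties as Unique
  open import Data.Product using (_×_; _,_)
  open import Data.Empty using (⊥)
  open import Relation.Binary.PropositionalEquality using (_≡_; refl; trans)

  module _ {A B : Set} (f : A → List B) where

    Unique-concatMap⁺ : ∀ {xs} → Unique xs → (∀ {x} → x ∈ xs → Unique (f x)) →
      (∀ {x x′ z} → x ∈ xs → x′ ∈ xs → z ∈ f x → z ∈ f x′ → x ≡ x′) → Unique (concatMap f xs)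
    Unique-concatMap⁺ {[]}     []              _  _        = []
    Unique-concatMap⁺ {x ∷ xs} (x∉xs ∷ uniq) uf disjoint =
      Unique.++⁺ (uf (here refl))
        (Unique-concatMap⁺ uniq (λ x∈ → uf (there x∈)) (λ x∈ x′∈ → disjoint (there x∈) (there x′∈)))
        apart
      where
      apart : ∀ {z} → z ∈ f x × z ∈ concatMap f xs → ⊥
      apart (z∈ , z∈′) with x′ , x′∈ , z∈″ ← find (∈-concatMap⁻ f z∈′) =
        All.lookup x∉xs x′∈ (disjoint (here refl) (there x′∈) z∈ z∈″)

  Unique-concatMap-map∷⁺ : ∀ {A : Set} (f : A → List (List A)) {xs} → Unique xs → (∀ x → Unique (f x)) →
    Unique (concatMap (λ x → map (x ∷_) (f x)) xs)
  Unique-concatMap-map∷⁺ f uniq uf =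
    Unique-concatMap⁺ (λ x → map (x ∷_) (f x)) uniq (λ {x} _ → Unique.map⁺ List.∷-injectiveʳ (uf x)) (λ _ _ → same-head)
    where
    same-head : ∀ {x x′ z} → z ∈ map (x ∷_) (f x) → z ∈ map (x′ ∷_) (f x′) → x ≡ x′
    same-head z∈ z∈′ with _ , _ , refl ← ∈-map⁻ _ z∈ | _ , _ , z≡ ← ∈-map⁻ _ z∈′ = List.∷-injectiveˡ z≡

  Unique-map⁺-on : ∀ {A B : Set} (f : A → B) {xs : List A} → Unique xs →
    (∀ {x y} → x ∈ xs → y ∈ xs → f x ≡ f y → x ≡ y) → Unique (map f xs)
  Unique-map⁺-on f []            _   = []
  Unique-map⁺-on f (x∉xs ∷ uniq) inj =
    All.tabulate (λ z∈ fx≡z → let (w , w∈ , z≡fw) = ∈-map⁻ f z∈ in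
                   All.lookup x∉xs w∈ (inj (here refl) (there w∈) (trans fx≡z z≡fw)))
    ∷ Unique-map⁺-on f uniq (λ x∈ y∈ → inj (there x∈) (there y∈))

module Compositions where

  open import Defs using (sgn; sumℤ; binomℤ; F)
  open import Data.Nat as ℕ using (ℕ; zero; suc)
  import Data.Nat.Properties as ℕ
  open import Data.Nat.Combinatorics using (_C_; nCk+nC[k+1]≡[n+1]C[k+1])
  open import Data.Nat.Combinatorics.Specification using (k>n⇒nCk≡0)
  open import Data.Integer as ℤ using (ℤ; +_; -[1+_]; _+_; _*_; _-_; -_; _<_)
  import Data.Integer.Properties as ℤ
  open import Data.Integer.Tactic.RingSolver using (solve-∀)
  open import Data.List using (List; []; _∷_; [_]; _++_; map; concatMap; length; upTo; applyUpTo)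
  import Data.List.Properties as List
  open import Data.Nat.ListAction using (sum)
  open import Data.List.Membership.Propositional using (_∈_; find; lose)
  open import Data.List.Membership.Propositional.Properties using (∈-concatMap⁻; ∈-concatMap⁺; ∈-map⁻; ∈-map⁺; ∈-upTo⁻; ∈-upTo⁺)
  open import Data.List.Relation.Unary.Any using (here)
  open import Data.List.Relation.Unary.All using (All; []; _∷_)
  open import Data.List.Relation.Unary.AllPairs using ([]; _∷_)
  open import Data.List.Relation.Unary.Unique.Propositional using (Unique)
  import Data.List.Relation.Unary.Unique.Propositional.Properties as Unique
  open import Data.Product using (_×_; _,_)
  open import Function using (_∘_; id)
  open UniqueLists using (Unique-concatMap-map∷⁺)
  open import Relation.Binary.PropositionalEquality hiding ([_])
  open ≡-Reasoning

  ∑< : ℕ → (ℕ → ℤ) → ℤ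
  ∑< zero    f = + 0
  ∑< (suc n) f = f 0 + ∑< n (f ∘ suc)

  infix 5 ∑<
  syntax ∑< n (λ j → e) = ∑[ j < n ] e

  ∑-cong : ∀ n {f g : ℕ → ℤ} → (∀ j → f j ≡ g j) → ∑< n f ≡ ∑< n g
  ∑-cong zero    eq = refl
  ∑-cong (suc n) eq = cong₂ _+_ (eq 0) (∑-cong n (eq ∘ suc))

  ∑-zero : ∀ n {f : ℕ → ℤ} → (∀ j → f j ≡ + 0) → ∑< n f ≡ + 0
  ∑-zero zero    eq = refl
  ∑-zero (suc n) eq = cong₂ _+_ (eq 0) (∑-zero n (eq ∘ suc))

  ∑-distrib-+ : ∀ n (f g : ℕ → ℤ) → ∑[ j < n ] f j + g j ≡ ∑< n f + ∑< n g
  ∑-distrib-+ zero    f g = refl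
  ∑-distrib-+ (suc n) f g = begin
    f 0 + g 0 + (∑[ j < n ] f (suc j) + g (suc j)) ≡⟨ cong (λ z → f 0 + g 0 + z) (∑-distrib-+ n (f ∘ suc) (g ∘ suc)) ⟩
    f 0 + g 0 + (∑< n (f ∘ suc) + ∑< n (g ∘ suc))  ≡⟨ interchange (f 0) (g 0) _ _ ⟩
    ∑< (suc n) f + ∑< (suc n) g                    ∎
    where
    interchange : ∀ a b c d → a + b + (c + d) ≡ a + c + (b + d)
    interchange = solve-∀

  ∑-neg : ∀ n (f : ℕ → ℤ) → ∑[ j < n ] - f j ≡ - ∑< n f
  ∑-neg zero    f = refl
  ∑-neg (suc n) f = trans (cong (_+_ (- f 0)) (∑-neg n (f ∘ suc))) (sym (ℤ.neg-distrib-+ (f 0) _))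

  ∑-last : ∀ n (f : ℕ → ℤ) → ∑< (suc n) f ≡ ∑< n f + f n
  ∑-last zero    f = ℤ.+-comm (f 0) (+ 0)
  ∑-last (suc n) f = trans (cong (_+_ (f 0)) (∑-last n (f ∘ suc))) (sym (ℤ.+-assoc (f 0) _ _))

  sumℤ-applyUpTo : ∀ n (f : ℕ → ℤ) (g : ℕ → ℕ) → sumℤ (map f (applyUpTo g n)) ≡ ∑< n (f ∘ g)
  sumℤ-applyUpTo zero    f g = refl
  sumℤ-applyUpTo (suc n) f g = cong (_+_ (f (g 0))) (sumℤ-applyUpTo n f (g ∘ suc))

  -- ((1 - E)^M φ)(0) for the shift E φ = φ ∘ suc.
  alternatingSum : ℕ → (ℕ → ℤ) → ℤ
  alternatingSum M φ = ∑[ j < suc M ] sgn j * + (M C j) * φ j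

  alternatingSum-cong : ∀ M {φ ψ : ℕ → ℤ} → (∀ j → φ j ≡ ψ j) → alternatingSum M φ ≡ alternatingSum M ψ
  alternatingSum-cong M eq = ∑-cong (suc M) (λ j → cong (sgn j * + (M C j) *_) (eq j))

  alternatingSum-zero : ∀ M {φ : ℕ → ℤ} → (∀ j → φ j ≡ + 0) → alternatingSum M φ ≡ + 0
  alternatingSum-zero M eq =
    ∑-zero (suc M) (λ j → trans (cong (sgn j * + (M C j) *_) (eq j)) (ℤ.*-zeroʳ (sgn j * + (M C j))))

  alternatingSum-+ : ∀ M (φ ψ : ℕ → ℤ) →
    alternatingSum M (λ j → φ j + ψ j) ≡ alternatingSum M φ + alternatingSum M ψ
  alternatingSum-+ M φ ψ = trans
    (∑-cong (suc M) (λ j → ℤ.*-distribˡ-+ (sgn j * + (M C j)) (φ j) (ψ j)))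
    (∑-distrib-+ (suc M) (λ j → sgn j * + (M C j) * φ j) (λ j → sgn j * + (M C j) * ψ j))

  alternatingSum-suc : ∀ M (φ : ℕ → ℤ) → alternatingSum (suc M) φ ≡ alternatingSum M φ - alternatingSum M (φ ∘ suc)
  alternatingSum-suc M φ = begin
    φ₀ + (∑[ j < suc M ] sgn (suc j) * + (suc M C suc j) * φ (suc j))
      ≡⟨ cong (_+_ φ₀) (∑-cong (suc M) pascal) ⟩
    φ₀ + (∑[ j < suc M ] - (sgn j * + (M C j) * φ (suc j)) + h j)
      ≡⟨ cong (_+_ φ₀) (∑-distrib-+ (suc M) (λ j → - (sgn j * + (M C j) * φ (suc j))) h) ⟩
    φ₀ + ((∑[ j < suc M ] - (sgn j * + (M C j) * φ (suc j))) + ∑< (suc M) h)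
      ≡⟨ cong₂ (λ x y → φ₀ + (x + y)) (∑-neg (suc M) (λ j → sgn j * + (M C j) * φ (suc j))) (∑-last M h) ⟩
    φ₀ + (- alternatingSum M (φ ∘ suc) + (∑< M h + h M))
      ≡⟨ cong (λ z → φ₀ + (- alternatingSum M (φ ∘ suc) + (∑< M h + z))) h-top ⟩
    φ₀ + (- alternatingSum M (φ ∘ suc) + (∑< M h + + 0))
      ≡⟨ rearrange φ₀ (alternatingSum M (φ ∘ suc)) (∑< M h) ⟩
    alternatingSum M φ - alternatingSum M (φ ∘ suc)
      ∎
    where
    φ₀ : ℤ
    φ₀ = sgn 0 * + (M C 0) * φ 0
    h : ℕ → ℤ
    h j = sgn (suc j) * + (M C suc j) * φ (suc j)
    distrib : ∀ s x y p → - s * (x + y) * p ≡ - (s * x * p) + - s * y * p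
    distrib = solve-∀
    pascal : ∀ j → sgn (suc j) * + (suc M C suc j) * φ (suc j) ≡ - (sgn j * + (M C j) * φ (suc j)) + h j
    pascal j = trans
      (cong (λ z → sgn (suc j) * z * φ (suc j))
        (trans (cong +_ (sym (nCk+nC[k+1]≡[n+1]C[k+1] M j))) (ℤ.pos-+ (M C j) (M C suc j))))
      (distrib (sgn j) (+ (M C j)) (+ (M C suc j)) (φ (suc j)))
    h-top : h M ≡ + 0
    h-top rewrite k>n⇒nCk≡0 (ℕ.n<1+n M) = trans (cong (_* φ (suc M)) (ℤ.*-zeroʳ (sgn (suc M)))) (ℤ.*-zeroˡ (φ (suc M)))
    rearrange : ∀ a b c → a + (- b + (c + + 0)) ≡ a + c - b
    rearrange = solve-∀

  binomℤ-pascal : ∀ x K → binomℤ (x + + 1) (+ suc K) ≡ binomℤ x (+ suc K) + binomℤ x (+ K)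
  binomℤ-pascal (+ n) K = begin
    + ((n ℕ.+ 1) C suc K)         ≡⟨ cong (λ m → + (m C suc K)) (ℕ.+-comm n 1) ⟩
    + (suc n C suc K)             ≡⟨ cong +_ (sym (nCk+nC[k+1]≡[n+1]C[k+1] n K)) ⟩
    + (n C K ℕ.+ n C suc K)       ≡⟨ ℤ.pos-+ (n C K) (n C suc K) ⟩
    + (n C K) + + (n C suc K)     ≡⟨ ℤ.+-comm (+ (n C K)) (+ (n C suc K)) ⟩
    + (n C suc K) + + (n C K)     ∎
  binomℤ-pascal -[1+ zero  ] K = refl
  binomℤ-pascal -[1+ suc n ] K = refl

  binomℤ-< : ∀ x K → x < + K → binomℤ x (+ K) ≡ + 0
  binomℤ-< (+ n)    K (ℤ.+<+ n<K) = cong +_ (k>n⇒nCk≡0 n<K)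
  binomℤ-< -[1+ n ] K _           = refl

  δ₀ : ℤ → ℤ
  δ₀ (+ zero) = + 1
  δ₀ _        = + 0

  binomℤ-0 : ∀ z → binomℤ z (+ 0) ≡ δ₀ z + binomℤ (z - + 1) (+ 0)
  binomℤ-0 (+ zero)  = refl
  binomℤ-0 (+ suc n) = refl
  binomℤ-0 -[1+ n ]  = refl

  ∑-δ₀ : ∀ n s → ∑[ y < n ] δ₀ (s - + y) ≡ binomℤ s (+ 0) - binomℤ (s - + n) (+ 0)
  ∑-δ₀ zero s = sym (trans (cong (λ z → binomℤ s (+ 0) - binomℤ z (+ 0)) (ℤ.+-identityʳ s)) (ℤ.+-inverseʳ (binomℤ s (+ 0))))
  ∑-δ₀ (suc n) s = begin
    ∑[ y < suc n ] δ₀ (s - + y)                                          ≡⟨ ∑-last n _ ⟩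
    (∑[ y < n ] δ₀ (s - + y)) + δ₀ (s - + n)                               ≡⟨ cong (_+ δ₀ (s - + n)) (∑-δ₀ n s) ⟩
    binomℤ s (+ 0) - binomℤ (s - + n) (+ 0) + δ₀ (s - + n)               ≡⟨ cong (λ z → binomℤ s (+ 0) - z + δ₀ (s - + n)) (binomℤ-0 (s - + n)) ⟩
    binomℤ s (+ 0) - (δ₀ (s - + n) + binomℤ (s - + n - + 1) (+ 0)) + δ₀ (s - + n)
      ≡⟨ cancel (binomℤ s (+ 0)) (δ₀ (s - + n)) _ ⟩
    binomℤ s (+ 0) - binomℤ (s - + n - + 1) (+ 0)                        ≡⟨ cong (λ z → binomℤ s (+ 0) - binomℤ z (+ 0)) (shift s (+ n)) ⟩
    binomℤ s (+ 0) - binomℤ (s - + suc n) (+ 0)                          ∎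
    where
    cancel : ∀ a b c → a - (b + c) + b ≡ a - c
    cancel = solve-∀
    shift : ∀ s x → s - x - + 1 ≡ s - (+ 1 + x)
    shift = solve-∀

  length-concatMap : ∀ {A B : Set} (f : A → List B) xs → + length (concatMap f xs) ≡ sumℤ (map (λ x → + length (f x)) xs)
  length-concatMap f []       = refl
  length-concatMap f (x ∷ xs) = begin
    + length (f x ++ concatMap f xs)            ≡⟨ cong +_ (List.length-++ (f x)) ⟩
    + (length (f x) ℕ.+ length (concatMap f xs)) ≡⟨ ℤ.pos-+ (length (f x)) _ ⟩
    + length (f x) + + length (concatMap f xs)  ≡⟨ cong (_+_ (+ length (f x))) (length-concatMap f xs) ⟩
    sumℤ (map (λ x → + length (f x)) (x ∷ xs))  ∎

  module _ (t : ℕ) where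

    -- Inclusion–exclusion count of the compositions of s into K + 1 parts in [0, t].
    inclusionExclusion : ℕ → ℤ → ℤ
    inclusionExclusion K s = alternatingSum (suc K) (λ j → binomℤ (s - + j * + suc t + + K) (+ K))

    inclusionExclusion-zero : ∀ s → inclusionExclusion 0 s ≡ binomℤ s (+ 0) - binomℤ (s - + suc t) (+ 0)
    inclusionExclusion-zero s =
      trans (cong₂ (λ x y → + 1 * + 1 * binomℤ x (+ 0) + (- + 1 * + 1 * binomℤ y (+ 0) + + 0)) (simp₀ s T) (simp₁ s T))
            (simp₂ (binomℤ s (+ 0)) (binomℤ (s - T) (+ 0)))
      where
      T : ℤ
      T = + suc t
      simp₀ : ∀ s T → s - + 0 * T + + 0 ≡ s
      simp₀ = solve-∀
      simp₁ : ∀ s T → s - + 1 * T + + 0 ≡ s - T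
      simp₁ = solve-∀
      simp₂ : ∀ a b → + 1 * + 1 * a + (- + 1 * + 1 * b + + 0) ≡ a - b
      simp₂ = solve-∀

    inclusionExclusion-negative : ∀ K s → s < + 0 → inclusionExclusion K s ≡ + 0
    inclusionExclusion-negative K s s<0 = alternatingSum-zero (suc K) (λ j → binomℤ-< _ K (top< j))
      where
      top< : ∀ j → s - + j * + suc t + + K < + K
      top< j = ℤ.+-monoˡ-< (+ K) (ℤ.≤-<-trans
        (subst (λ z → s - z ℤ.≤ s) (ℤ.pos-* j (suc t)) (ℤ.i-j≤i s (+ (j ℕ.* suc t)))) s<0)

    -- Pascal's rule in the top entry, then (1 - E)^{K+2} = (1 - E)^{K+1} - (1 - E)^{K+1} E.
    inclusionExclusion-diff : ∀ K s →
      inclusionExclusion (suc K) s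
        ≡ inclusionExclusion (suc K) (s - + 1) + (inclusionExclusion K s - inclusionExclusion K (s - + suc t))
    inclusionExclusion-diff K s = begin
      inclusionExclusion (suc K) s
        ≡⟨ alternatingSum-cong (suc (suc K)) split ⟩
      alternatingSum (suc (suc K)) (λ j → f j + g j)
        ≡⟨ alternatingSum-+ (suc (suc K)) f g ⟩
      inclusionExclusion (suc K) (s - + 1) + alternatingSum (suc (suc K)) g
        ≡⟨ cong (_+_ (inclusionExclusion (suc K) (s - + 1))) (alternatingSum-suc (suc K) g) ⟩
      inclusionExclusion (suc K) (s - + 1) + (inclusionExclusion K s - alternatingSum (suc K) (g ∘ suc))
        ≡⟨ cong (λ z → inclusionExclusion (suc K) (s - + 1) + (inclusionExclusion K s - z)) (alternatingSum-cong (suc K) shift) ⟩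
      inclusionExclusion (suc K) (s - + 1) + (inclusionExclusion K s - inclusionExclusion K (s - + suc t))
        ∎
      where
      T : ℤ
      T = + suc t
      f g : ℕ → ℤ
      f j = binomℤ (s - + 1 - + j * T + + suc K) (+ suc K)
      g j = binomℤ (s - + j * T + + K) (+ K)
      top-suc : ∀ s j T K → s - j * T + (+ 1 + K) ≡ s - + 1 - j * T + (+ 1 + K) + + 1
      top-suc = solve-∀
      top-pred : ∀ s j T K → s - + 1 - j * T + (+ 1 + K) ≡ s - j * T + K
      top-pred = solve-∀
      split : ∀ j → binomℤ (s - + j * T + + suc K) (+ suc K) ≡ f j + g j
      split j = begin
        binomℤ (s - + j * T + + suc K) (+ suc K)
          ≡⟨ cong (λ z → binomℤ z (+ suc K)) (top-suc s (+ j) T (+ K)) ⟩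
        binomℤ (s - + 1 - + j * T + + suc K + + 1) (+ suc K)
          ≡⟨ binomℤ-pascal (s - + 1 - + j * T + + suc K) K ⟩
        f j + binomℤ (s - + 1 - + j * T + + suc K) (+ K)
          ≡⟨ cong (λ z → f j + binomℤ z (+ K)) (top-pred s (+ j) T (+ K)) ⟩
        f j + g j
          ∎
      shift-top : ∀ s j T K → s - (+ 1 + j) * T + K ≡ s - T - j * T + K
      shift-top = solve-∀
      shift : ∀ j → g (suc j) ≡ binomℤ (s - T - + j * T + + K) (+ K)
      shift j = cong (λ z → binomℤ z (+ K)) (shift-top s (+ j) T (+ K))

    private
      -- Both sides satisfy the difference equation of inclusionExclusion-diff in s.
      inclusionExclusion-suc-step : ∀ K s →
        inclusionExclusion (suc K) (s - + 1) ≡ (∑[ y < suc t ] inclusionExclusion K (s - + 1 - + y)) →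
        inclusionExclusion (suc K) s ≡ (∑[ y < suc t ] inclusionExclusion K (s - + y))
      inclusionExclusion-suc-step K s ih = begin
        inclusionExclusion (suc K) s
          ≡⟨ inclusionExclusion-diff K s ⟩
        inclusionExclusion (suc K) (s - + 1) + (G s - G (s - + suc t))
          ≡⟨ cong (_+ (G s - G (s - + suc t))) (trans ih (∑-last t (λ y → G (s - + 1 - + y)))) ⟩
        (∑[ y < t ] G (s - + 1 - + y)) + G (s - + 1 - + t) + (G s - G (s - + suc t))
          ≡⟨ cong₂ (λ x z → x + G z + (G s - G (s - + suc t))) (∑-cong t (λ y → cong G (pred-sub s (+ y)))) (pred-sub s (+ t)) ⟩
        Σ′ + G (s - + suc t) + (G s - G (s - + suc t))
          ≡⟨ cancel Σ′ (G (s - + suc t)) (G s) ⟩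
        G s + Σ′
          ≡⟨ cong (λ z → G z + Σ′) (sym (ℤ.+-identityʳ s)) ⟩
        (∑[ y < suc t ] G (s - + y))
          ∎
        where
        G : ℤ → ℤ
        G = inclusionExclusion K
        Σ′ : ℤ
        Σ′ = ∑[ y < t ] G (s - + suc y)
        pred-sub : ∀ s y → s - + 1 - y ≡ s - (+ 1 + y)
        pred-sub = solve-∀
        cancel : ∀ a b c → a + b + (c - b) ≡ c + a
        cancel = solve-∀

    inclusionExclusion-suc : ∀ K s → inclusionExclusion (suc K) s ≡ ∑[ y < suc t ] inclusionExclusion K (s - + y)
    inclusionExclusion-suc K -[1+ n ] =
      trans (inclusionExclusion-negative (suc K) -[1+ n ] ℤ.-<+)
            (sym (∑-zero (suc t) (λ y → inclusionExclusion-negative K _ (ℤ.≤-<-trans (ℤ.i-j≤i -[1+ n ] (+ y)) ℤ.-<+))))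
    inclusionExclusion-suc K (+ zero)  = inclusionExclusion-suc-step K (+ zero) (inclusionExclusion-suc K -[1+ 0 ])
    inclusionExclusion-suc K (+ suc n) = inclusionExclusion-suc-step K (+ suc n) (inclusionExclusion-suc K (+ n))

    compositions : ℕ → ℤ → List (List ℕ)
    compositions zero    (+ zero) = [ [] ]
    compositions zero    _        = []
    compositions (suc N) s = concatMap (λ y → map (y ∷_) (compositions N (s - + y))) (upTo (suc t))

    length-compositions-zero : ∀ z → + length (compositions 0 z) ≡ δ₀ z
    length-compositions-zero (+ zero)  = refl
    length-compositions-zero (+ suc n) = refl
    length-compositions-zero -[1+ n ]  = refl

    length-compositions-suc : ∀ N s →
      + length (compositions (suc N) s) ≡ ∑[ y < suc t ] + length (compositions N (s - + y))
    length-compositions-suc N s = begin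
      + length (compositions (suc N) s)
        ≡⟨ length-concatMap (λ y → map (y ∷_) (compositions N (s - + y))) (upTo (suc t)) ⟩
      sumℤ (map (λ y → + length (map (y ∷_) (compositions N (s - + y)))) (upTo (suc t)))
        ≡⟨ sumℤ-applyUpTo (suc t) (λ y → + length (map (y ∷_) (compositions N (s - + y)))) id ⟩
      ∑[ y < suc t ] + length (map (y ∷_) (compositions N (s - + y)))
        ≡⟨ ∑-cong (suc t) (λ y → cong +_ (List.length-map (y ∷_) (compositions N (s - + y)))) ⟩
      ∑[ y < suc t ] + length (compositions N (s - + y))
        ∎

    length-compositions : ∀ K s → + length (compositions (suc K) s) ≡ inclusionExclusion K s
    length-compositions zero s = begin
      + length (compositions 1 s)                         ≡⟨ length-compositions-suc 0 s ⟩
      ∑[ y < suc t ] + length (compositions 0 (s - + y))  ≡⟨ ∑-cong (suc t) (λ y → length-compositions-zero (s - + y)) ⟩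
      ∑[ y < suc t ] δ₀ (s - + y)                         ≡⟨ ∑-δ₀ (suc t) s ⟩
      binomℤ s (+ 0) - binomℤ (s - + suc t) (+ 0)         ≡⟨ inclusionExclusion-zero s ⟨
      inclusionExclusion 0 s                            ∎
    length-compositions (suc K) s = begin
      + length (compositions (suc (suc K)) s)                     ≡⟨ length-compositions-suc (suc K) s ⟩
      ∑[ y < suc t ] + length (compositions (suc K) (s - + y))    ≡⟨ ∑-cong (suc t) (λ y → length-compositions K (s - + y)) ⟩
      ∑[ y < suc t ] inclusionExclusion K (s - + y)             ≡⟨ inclusionExclusion-suc K s ⟨
      inclusionExclusion (suc K) s                              ∎

    F≡inclusionExclusion : ∀ a b c K → a ℕ.+ b ≡ suc K → F a b c t ≡ inclusionExclusion K (+ (t ℕ.* b) + c)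
    F≡inclusionExclusion a b c K a+b≡1+K = begin
      F a b c t
        ≡⟨ sumℤ-applyUpTo (suc (a ℕ.+ b)) (λ j → sgn j * + ((a ℕ.+ b) C j) * binomℤ (+ suc t * (+ b - + j) + + a + c - + 1) (+ (a ℕ.+ b) - + 1)) id ⟩
      (∑[ j < suc (a ℕ.+ b) ] sgn j * + ((a ℕ.+ b) C j) * binomℤ (+ suc t * (+ b - + j) + + a + c - + 1) (+ (a ℕ.+ b) - + 1))
        ≡⟨ ∑-cong (suc (a ℕ.+ b)) (λ j → cong₂ (λ N x → sgn j * + (N C j) * binomℤ x (+ N - + 1)) a+b≡1+K (top j)) ⟩
      (∑[ j < suc (a ℕ.+ b) ] sgn j * + (suc K C j) * binomℤ (s - + j * + suc t + + K) (+ K))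
        ≡⟨ cong (λ N → ∑[ j < suc N ] sgn j * + (suc K C j) * binomℤ (s - + j * + suc t + + K) (+ K)) a+b≡1+K ⟩
      inclusionExclusion K s
        ∎
      where
      s : ℤ
      s = + (t ℕ.* b) + c
      regroup : ∀ T B J A C → (+ 1 + T) * (B - J) + A + C - + 1 ≡ (T * B + C) - J * (+ 1 + T) + (A + B - + 1)
      regroup = solve-∀
      a+b-1 : + a + + b - + 1 ≡ + K
      a+b-1 = cong (_- + 1) (trans (sym (ℤ.pos-+ a b)) (cong +_ a+b≡1+K))
      top : ∀ j → + suc t * (+ b - + j) + + a + c - + 1 ≡ s - + j * + suc t + + K
      top j = trans (regroup (+ t) (+ b) (+ j) (+ a) c)
                    (cong₂ (λ x y → x + c - + j * + suc t + y) (sym (ℤ.pos-* t b)) a+b-1)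

    length-compositions≡F : ∀ a b c → 0 ℕ.< b → + length (compositions (a ℕ.+ b) (+ (t ℕ.* b) + c)) ≡ F a b c t
    length-compositions≡F a (suc b) c _ = begin
      + length (compositions (a ℕ.+ suc b) s)     ≡⟨ cong (λ N → + length (compositions N s)) (ℕ.+-suc a b) ⟩
      + length (compositions (suc (a ℕ.+ b)) s)   ≡⟨ length-compositions (a ℕ.+ b) s ⟩
      inclusionExclusion (a ℕ.+ b) s            ≡⟨ F≡inclusionExclusion a (suc b) c (a ℕ.+ b) (ℕ.+-suc a b) ⟨
      F a (suc b) c t                             ∎
      where
      s : ℤ
      s = + (t ℕ.* suc b) + c

    ∈-compositions⁻ : ∀ N s ys → ys ∈ compositions N s → length ys ≡ N × All (ℕ._≤ t) ys × + sum ys ≡ s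
    ∈-compositions⁻ zero (+ zero) .[] (here refl) = refl , [] , refl
    ∈-compositions⁻ (suc N) s ys ys∈
      with y , y∈ , ys∈′ ← find (∈-concatMap⁻ (λ y → map (y ∷_) (compositions N (s - + y))) {xs = upTo (suc t)} ys∈)
      with zs , zs∈ , refl ← ∈-map⁻ (y ∷_) ys∈′
      with len , ≤t , sum≡ ← ∈-compositions⁻ N (s - + y) zs zs∈
      = cong suc len , ℕ.≤-pred (∈-upTo⁻ y∈) ∷ ≤t , (begin
        + (y ℕ.+ sum zs)     ≡⟨ ℤ.pos-+ y (sum zs) ⟩
        + y + + sum zs       ≡⟨ cong (_+_ (+ y)) sum≡ ⟩
        + y + (s - + y)      ≡⟨ cancel (+ y) s ⟩
        s                    ∎)
      where
      cancel : ∀ y s → y + (s - y) ≡ s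
      cancel = solve-∀

    ∈-compositions⁺ : ∀ N s ys → length ys ≡ N → All (ℕ._≤ t) ys → + sum ys ≡ s → ys ∈ compositions N s
    ∈-compositions⁺ zero    .(+ 0) []       len        []        refl = here refl
    ∈-compositions⁺ (suc N) s      (y ∷ zs) len (y≤ ∷ ≤t) sum≡ =
      ∈-concatMap⁺ (λ y → map (y ∷_) (compositions N (s - + y))) {xs = upTo (suc t)}
        (lose (∈-upTo⁺ (ℕ.s≤s y≤)) (∈-map⁺ (y ∷_) (∈-compositions⁺ N (s - + y) zs (ℕ.suc-injective len) ≤t sum≡′)))
      where
      cancel : ∀ y s → s ≡ y + s - y
      cancel = solve-∀
      sum≡′ : + sum zs ≡ s - + y
      sum≡′ = trans (cancel (+ y) (+ sum zs)) (cong (_- + y) (trans (sym (ℤ.pos-+ y (sum zs))) sum≡))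

    Unique-compositions : ∀ N s → Unique (compositions N s)
    Unique-compositions zero    (+ zero)  = [] ∷ []
    Unique-compositions zero    (+ suc n) = []
    Unique-compositions zero    -[1+ n ]  = []
    Unique-compositions (suc N) s =
      Unique-concatMap-map∷⁺ (λ y → compositions N (s - + y)) (Unique.upTo⁺ (suc t)) (λ y → Unique-compositions N (s - + y))

module Walks where

  open import Data.Bool using (Bool; true; false)
  open import Data.Nat using (ℕ; zero; suc; _+_; _*_; _∸_; _≤_; _⊓_; z≤n)
  open import Data.Nat.Properties
  open import Data.Nat.ListAction using (sum)
  open import Data.Nat.ListAction.Properties using (sum-++)
  open import Data.Nat.Tactic.RingSolver using (solve-∀)
  open import Data.List using (List; []; _∷_; _++_; length; replicate; take; drop)
  open import Data.List.Properties using (length-++; length-take; length-drop; take++drop≡id)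
  open import Data.List.Relation.Unary.All using (All; []; _∷_)
  import Data.List.Relation.Unary.All.Properties as All
  open import Data.Product using (_×_; _,_; Σ-syntax)
  open import Data.Empty using (⊥)
  open import Relation.Binary.PropositionalEquality

  -- Walk t d w y d′: reading the word w with weights y ∈ [0, t], every letter adds its weight to the
  -- slack and every 1 removes t from it, which must never make it negative; the slack runs from d to d′.
  -- So Walk t 0 S y 0 says that the prefix sums of y dominate t times those of the indicator word S,
  -- with equality at the end.
  Walk : ℕ → ℕ → List Bool → List ℕ → ℕ → Set
  Walk t d []          []       d′ = d ≡ d′
  Walk t d []          (_ ∷ _)  d′ = ⊥
  Walk t d (_ ∷ _)     []       d′ = ⊥
  Walk t d (false ∷ w) (y ∷ ys) d′ = y ≤ t × Walk t (d + y) w ys d′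
  Walk t d (true ∷ w)  (y ∷ ys) d′ = y ≤ t × t ≤ d + y × Walk t (d + y ∸ t) w ys d′

  Walk-++⁺ : ∀ {t d d′ d″} w₁ {w₂ y₁ y₂} → Walk t d w₁ y₁ d′ → Walk t d′ w₂ y₂ d″ → Walk t d (w₁ ++ w₂) (y₁ ++ y₂) d″
  Walk-++⁺ []          {y₁ = []}    refl           h₂ = h₂
  Walk-++⁺ (false ∷ w) {y₁ = _ ∷ _} (y≤ , h₁)      h₂ = y≤ , Walk-++⁺ w h₁ h₂
  Walk-++⁺ (true ∷ w)  {y₁ = _ ∷ _} (y≤ , t≤ , h₁) h₂ = y≤ , t≤ , Walk-++⁺ w h₁ h₂

  Walk-++⁻ : ∀ {t d d″} w₁ {w₂} ys → Walk t d (w₁ ++ w₂) ys d″ →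
    Σ[ y₁ ∈ List ℕ ] Σ[ y₂ ∈ List ℕ ] Σ[ d′ ∈ ℕ ] (ys ≡ y₁ ++ y₂ × Walk t d w₁ y₁ d′ × Walk t d′ w₂ y₂ d″)
  Walk-++⁻ {d = d} []  ys       h = [] , ys , d , refl , refl , h
  Walk-++⁻ (false ∷ w) (y ∷ ys) (y≤ , h) with Walk-++⁻ w ys h
  ... | y₁ , y₂ , d′ , refl , h₁ , h₂ = y ∷ y₁ , y₂ , d′ , refl , (y≤ , h₁) , h₂
  Walk-++⁻ (true ∷ w)  (y ∷ ys) (y≤ , t≤ , h) with Walk-++⁻ w ys h
  ... | y₁ , y₂ , d′ , refl , h₁ , h₂ = y ∷ y₁ , y₂ , d′ , refl , (y≤ , t≤ , h₁) , h₂

  Walk-length : ∀ {t d d′} w ys → Walk t d w ys d′ → length ys ≡ length w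
  Walk-length []          []       h           = refl
  Walk-length (false ∷ w) (y ∷ ys) (_ , h)     = cong suc (Walk-length w ys h)
  Walk-length (true ∷ w)  (y ∷ ys) (_ , _ , h) = cong suc (Walk-length w ys h)

  sum≤*length : ∀ t ys → All (_≤ t) ys → sum ys ≤ t * length ys
  sum≤*length t []       []       = z≤n
  sum≤*length t (y ∷ ys) (p ∷ ps) =
    ≤-trans (+-mono-≤ p (sum≤*length t ys ps)) (≤-reflexive (sym (*-suc t (length ys))))

  count1 : List Bool → ℕ
  count1 []          = 0
  count1 (true ∷ w)  = suc (count1 w)
  count1 (false ∷ w) = count1 w

  count1-++ : ∀ w₁ w₂ → count1 (w₁ ++ w₂) ≡ count1 w₁ + count1 w₂
  count1-++ []           w₂ = refl
  count1-++ (true ∷ w₁)  w₂ = cong suc (count1-++ w₁ w₂)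
  count1-++ (false ∷ w₁) w₂ = count1-++ w₁ w₂

  Walk-slack≤ : ∀ t d w ys → Walk t d w ys 0 → d ≤ t * count1 w
  Walk-slack≤ t d []          []       refl        = z≤n
  Walk-slack≤ t d (false ∷ w) (y ∷ ys) (_ , h)     = ≤-trans (m≤m+n d y) (Walk-slack≤ t (d + y) w ys h)
  Walk-slack≤ t d (true ∷ w)  (y ∷ ys) (_ , t≤ , h) = begin
    d                         ≤⟨ m≤m+n d y ⟩
    d + y                     ≡⟨ m∸n+n≡m t≤ ⟨
    d + y ∸ t + t             ≤⟨ +-monoˡ-≤ t (Walk-slack≤ t (d + y ∸ t) w ys h) ⟩
    t * count1 w + t          ≡⟨ +-comm (t * count1 w) t ⟩
    t + t * count1 w          ≡⟨ *-suc t (count1 w) ⟨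
    t * count1 (true ∷ w)     ∎
    where open ≤-Reasoning

  block : ℕ → ℕ → List Bool
  block a b = replicate a false ++ replicate b true

  count1-block : ∀ a b → count1 (block a b) ≡ b
  count1-block (suc a) b       = count1-block a b
  count1-block zero    zero    = refl
  count1-block zero    (suc b) = cong suc (count1-block zero b)

  private
    Walk-zeros⇒ : ∀ t d a ys d′ → Walk t d (replicate a false) ys d′ →
      length ys ≡ a × All (_≤ t) ys × d′ ≡ d + sum ys
    Walk-zeros⇒ t d zero    []       d′ refl = refl , [] , sym (+-identityʳ d)
    Walk-zeros⇒ t d (suc a) (y ∷ ys) d′ (y≤ , h) with Walk-zeros⇒ t (d + y) a ys d′ h
    ... | len , ≤t , d′≡ = cong suc len , y≤ ∷ ≤t , trans d′≡ (+-assoc d y (sum ys))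

    Walk-zeros⇐ : ∀ t d a ys d′ → length ys ≡ a → All (_≤ t) ys → d′ ≡ d + sum ys → Walk t d (replicate a false) ys d′
    Walk-zeros⇐ t d zero    []       d′ len        []         d′≡ = trans (sym (+-identityʳ d)) (sym d′≡)
    Walk-zeros⇐ t d (suc a) (y ∷ ys) d′ len (y≤ ∷ ≤t) d′≡ =
      y≤ , Walk-zeros⇐ t (d + y) a ys d′ (suc-injective len) ≤t (trans d′≡ (sym (+-assoc d y (sum ys))))

    Walk-ones⇒ : ∀ t d b ys d′ → Walk t d (replicate b true) ys d′ →
      length ys ≡ b × All (_≤ t) ys × d′ + t * b ≡ d + sum ys
    Walk-ones⇒ t d zero    []       d′ refl = refl , [] , cong (d′ +_) (*-zeroʳ t)
    Walk-ones⇒ t d (suc b) (y ∷ ys) d′ (y≤ , t≤ , h) with Walk-ones⇒ t (d + y ∸ t) b ys d′ h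
    ... | len , ≤t , d′≡ = cong suc len , y≤ ∷ ≤t , (begin
      d′ + t * suc b            ≡⟨ cong (d′ +_) (*-suc t b) ⟩
      d′ + (t + t * b)          ≡⟨ swap d′ t (t * b) ⟩
      t + (d′ + t * b)          ≡⟨ cong (t +_) d′≡ ⟩
      t + (d + y ∸ t + sum ys)  ≡⟨ +-assoc t (d + y ∸ t) (sum ys) ⟨
      t + (d + y ∸ t) + sum ys  ≡⟨ cong (_+ sum ys) (m+[n∸m]≡n t≤) ⟩
      d + y + sum ys            ≡⟨ +-assoc d y (sum ys) ⟩
      d + (y + sum ys)          ∎)
      where
      open ≡-Reasoning
      swap : ∀ d′ t tb → d′ + (t + tb) ≡ t + (d′ + tb)
      swap = solve-∀

    -- The slack only decreases along a run of 1s, so its final value bounds all the intermediate ones.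
    Walk-ones⇐ : ∀ t d b ys d′ → length ys ≡ b → All (_≤ t) ys → d′ + t * b ≡ d + sum ys → Walk t d (replicate b true) ys d′
    Walk-ones⇐ t d zero    []       d′ len        []         d′≡ =
      trans (sym (+-identityʳ d)) (trans (sym d′≡) (trans (cong (d′ +_) (*-zeroʳ t)) (+-identityʳ d′)))
    Walk-ones⇐ t d (suc b) (y ∷ ys) d′ len (y≤ ∷ ≤t) d′≡ = y≤ , t≤d+y , Walk-ones⇐ t (d + y ∸ t) b ys d′ len′ ≤t d″≡
      where
      len′ : length ys ≡ b
      len′ = suc-injective len
      open ≡-Reasoning
      rearrange : ∀ t d′ b → t + d′ + t * b ≡ d′ + t * (1 + b)
      rearrange = solve-∀
      regroup : t + d′ + t * b ≡ d + y + sum ys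
      regroup = trans (rearrange t d′ b) (trans d′≡ (sym (+-assoc d y (sum ys))))
      t≤d+y : t ≤ d + y
      t≤d+y = ≤-trans (m≤m+n t d′) (+-cancelʳ-≤ (t * b) (t + d′) (d + y)
        (≤-trans (≤-reflexive regroup) (+-monoʳ-≤ (d + y) (subst (λ n → sum ys ≤ t * n) len′ (sum≤*length t ys ≤t)))))
      rotate : ∀ a b c → a + b + c ≡ c + a + b
      rotate = solve-∀
      swap : ∀ a b c → a + b + c ≡ a + c + b
      swap = solve-∀
      d″≡ : d′ + t * b ≡ d + y ∸ t + sum ys
      d″≡ = +-cancelʳ-≡ t _ _ (begin
        d′ + t * b + t          ≡⟨ rotate d′ (t * b) t ⟩
        t + d′ + t * b          ≡⟨ regroup ⟩
        d + y + sum ys          ≡⟨ cong (_+ sum ys) (m∸n+n≡m t≤d+y) ⟨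
        d + y ∸ t + t + sum ys  ≡⟨ swap (d + y ∸ t) t (sum ys) ⟩
        d + y ∸ t + sum ys + t  ∎)

  Walk-block⇒ : ∀ t d a b ys d′ → Walk t d (block a b) ys d′ →
    length ys ≡ a + b × All (_≤ t) ys × d′ + t * b ≡ d + sum ys
  Walk-block⇒ t d a b ys d′ h with Walk-++⁻ (replicate a false) ys h
  ... | y₁ , y₂ , d₁ , refl , h₁ , h₂ with Walk-zeros⇒ t d a y₁ d₁ h₁ | Walk-ones⇒ t d₁ b y₂ d′ h₂
  ... | len₁ , ≤t₁ , d₁≡ | len₂ , ≤t₂ , d′≡ =
    trans (length-++ y₁) (cong₂ _+_ len₁ len₂) , All.++⁺ ≤t₁ ≤t₂ , (begin
      d′ + t * b              ≡⟨ d′≡ ⟩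
      d₁ + sum y₂             ≡⟨ cong (_+ sum y₂) d₁≡ ⟩
      d + sum y₁ + sum y₂     ≡⟨ +-assoc d (sum y₁) (sum y₂) ⟩
      d + (sum y₁ + sum y₂)   ≡⟨ cong (d +_) (sum-++ y₁ y₂) ⟨
      d + sum (y₁ ++ y₂)      ∎)
    where open ≡-Reasoning

  Walk-block⇐ : ∀ t d a b ys d′ → length ys ≡ a + b → All (_≤ t) ys → d′ + t * b ≡ d + sum ys →
    Walk t d (block a b) ys d′
  Walk-block⇐ t d a b ys d′ len ≤t d′≡ =
    subst (λ zs → Walk t d (block a b) zs d′) (take++drop≡id a ys)
      (Walk-++⁺ (replicate a false)
        (Walk-zeros⇐ t d a (take a ys) _ len₁ (All.take⁺ a ≤t) refl)
        (Walk-ones⇐ t (d + sum (take a ys)) b (drop a ys) d′ len₂ (All.drop⁺ a ≤t) d′≡′))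
    where
    len₁ : length (take a ys) ≡ a
    len₁ = trans (length-take a ys) (trans (cong (a ⊓_) len) (m≤n⇒m⊓n≡m (m≤m+n a b)))
    len₂ : length (drop a ys) ≡ b
    len₂ = trans (length-drop a ys) (trans (cong (_∸ a) len) (m+n∸m≡n a b))
    open ≡-Reasoning
    d′≡′ : d′ + t * b ≡ d + sum (take a ys) + sum (drop a ys)
    d′≡′ = begin
      d′ + t * b                                 ≡⟨ d′≡ ⟩
      d + sum ys                                 ≡⟨ cong (λ zs → d + sum zs) (take++drop≡id a ys) ⟨
      d + sum (take a ys ++ drop a ys)           ≡⟨ cong (d +_) (sum-++ (take a ys) (drop a ys)) ⟩
      d + (sum (take a ys) + sum (drop a ys))    ≡⟨ +-assoc d _ _ ⟨
      d + sum (take a ys) + sum (drop a ys)      ∎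

module IntegerBoxes where

  open import Defs using (intRange; box)
  open import Data.Bool using (true; false; T)
  open import Data.Unit using (tt)
  open import Data.Nat as ℕ using (ℕ; s≤s)
  open import Data.Integer using (ℤ; +_; _+_; -_; _-_; _≤_; _≤ᵇ_; ∣_∣; +≤+)
  open import Data.Integer.Properties
  open import Data.Integer.Tactic.RingSolver using (solve-∀)
  open import Data.List using (List; []; _∷_; map)
  open import Data.List.Membership.Propositional using (_∈_; find; lose)
  open import Data.List.Membership.Propositional.Properties using (∈-concatMap⁻; ∈-concatMap⁺; ∈-map⁻; ∈-map⁺; ∈-upTo⁻; ∈-upTo⁺)
  open import Data.List.Relation.Unary.Any using (here)
  open import Data.List.Relation.Binary.Pointwise using (Pointwise; []; _∷_)
  open import Data.List.Relation.Unary.All using ([])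
  open import Data.List.Relation.Unary.AllPairs using ([]; _∷_)
  open import Data.List.Relation.Unary.Unique.Propositional using (Unique)
  import Data.List.Relation.Unary.Unique.Propositional.Properties as Unique
  open import Data.Product using (_×_; _,_; proj₁; proj₂)
  open import Data.Empty using (⊥-elim)
  open import Relation.Binary.PropositionalEquality hiding ([_])
  open UniqueLists using (Unique-concatMap-map∷⁺)

  private
    +∣-∣-diff : ∀ {i j} → i ≤ j → + ∣ j - i ∣ ≡ j - i
    +∣-∣-diff i≤j = 0≤i⇒+∣i∣≡i (i≤j⇒0≤j-i i≤j)

    +-diff : ∀ i j → i + (j - i) ≡ j
    +-diff = solve-∀

    +-cancelˡ : ∀ i {j k} → i + j ≡ i + k → j ≡ k
    +-cancelˡ i {j} {k} eq = trans (sym (neg-cancel i j)) (trans (cong (_+_ (- i)) eq) (neg-cancel i k))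
      where
      neg-cancel : ∀ i j → - i + (i + j) ≡ j
      neg-cancel = solve-∀

  ∈-intRange⁻ : ∀ lo hi {c} → c ∈ intRange lo hi → lo ≤ c × c ≤ hi
  ∈-intRange⁻ lo hi c∈ with lo ≤ᵇ hi in lo≤ᵇhi
  ... | true with k , k∈ , refl ← ∈-map⁻ (λ k → lo + + k) c∈ = i≤i+j lo (+ k) , (begin
    lo + + k                ≤⟨ +-monoʳ-≤ lo (+≤+ (ℕ.≤-pred (∈-upTo⁻ k∈))) ⟩
    lo + + ∣ hi - lo ∣      ≡⟨ cong (_+_ lo) (+∣-∣-diff lo≤hi) ⟩
    lo + (hi - lo)          ≡⟨ +-diff lo hi ⟩
    hi                      ∎)
    where
    open ≤-Reasoning
    lo≤hi : lo ≤ hi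
    lo≤hi = ≤ᵇ⇒≤ (subst T (sym lo≤ᵇhi) tt)

  ∈-intRange⁺ : ∀ {lo hi c} → lo ≤ c → c ≤ hi → c ∈ intRange lo hi
  ∈-intRange⁺ {lo} {hi} {c} lo≤c c≤hi with lo ≤ᵇ hi in lo≤ᵇhi
  ... | false = ⊥-elim (subst T lo≤ᵇhi (≤⇒≤ᵇ (≤-trans lo≤c c≤hi)))
  ... | true  = subst (_∈ _) (trans (cong (_+_ lo) (+∣-∣-diff lo≤c)) (+-diff lo c))
                  (∈-map⁺ (λ k → lo + + k) (∈-upTo⁺ (s≤s k≤)))
    where
    k≤ : ∣ c - lo ∣ ℕ.≤ ∣ hi - lo ∣
    k≤ with +≤+ k≤′ ← subst₂ _≤_ (sym (+∣-∣-diff lo≤c)) (sym (+∣-∣-diff (≤-trans lo≤c c≤hi))) (+-monoˡ-≤ (- lo) c≤hi) = k≤′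

  Unique-intRange : ∀ lo hi → Unique (intRange lo hi)
  Unique-intRange lo hi with lo ≤ᵇ hi
  ... | true  = Unique.map⁺ (λ eq → +-injective (+-cancelˡ lo eq)) (Unique.upTo⁺ _)
  ... | false = []

  InBox : List (ℤ × ℤ) → List ℤ → Set
  InBox = Pointwise (λ bound c → proj₁ bound ≤ c × c ≤ proj₂ bound)

  ∈-box⁻ : ∀ bs {cs} → cs ∈ box bs → InBox bs cs
  ∈-box⁻ [] (here refl) = []
  ∈-box⁻ ((lo , hi) ∷ bs) cs∈
    with c , c∈ , cs∈′ ← find (∈-concatMap⁻ (λ c → map (c ∷_) (box bs)) {xs = intRange lo hi} cs∈)
    with cs′ , cs′∈ , refl ← ∈-map⁻ (c ∷_) cs∈′
    = ∈-intRange⁻ lo hi c∈ ∷ ∈-box⁻ bs cs′∈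

  ∈-box⁺ : ∀ {bs cs} → InBox bs cs → cs ∈ box bs
  ∈-box⁺ [] = here refl
  ∈-box⁺ {(lo , hi) ∷ bs} {c ∷ cs} ((lo≤c , c≤hi) ∷ inBox) =
    ∈-concatMap⁺ (λ c → map (c ∷_) (box bs)) {xs = intRange lo hi}
      (lose (∈-intRange⁺ lo≤c c≤hi) (∈-map⁺ (c ∷_) (∈-box⁺ inBox)))

  Unique-box : ∀ bs → Unique (box bs)
  Unique-box []               = [] ∷ []
  Unique-box ((lo , hi) ∷ bs) = Unique-concatMap-map∷⁺ (λ _ → box bs) (Unique-intRange lo hi) (λ _ → Unique-box bs)

module BlockEnumeration where

  open import Defs using (admissible; box; sumℤ; prodℤ; F)
  open import Data.Bool using (Bool; T)
  import Data.Bool.Properties as Bool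
  open import Data.Unit using (tt)
  open import Data.Nat as ℕ using (ℕ; suc; z≤n; _⊓_)
  import Data.Nat.Properties as ℕ
  open import Data.Nat.ListAction using (sum)
  import Data.Nat.Tactic.RingSolver as ℕ-Solver
  open import Data.Integer as ℤ using (ℤ; +_; -_; +≤+)
  import Data.Integer.Properties as ℤ
  open import Data.Integer.Tactic.RingSolver using (solve-∀)
  open import Data.List using (List; []; _∷_; [_]; _++_; map; concatMap; length; take; drop; zip; filterᵇ)
  import Data.List.Properties as List
  open import Data.List.Membership.Propositional using (_∈_; find; lose)
  open import Data.List.Membership.Propositional.Properties using (∈-concatMap⁻; ∈-concatMap⁺; ∈-map⁻; ∈-map⁺; ∈-filter⁻; ∈-filter⁺)
  open import Data.List.Relation.Unary.Any using (here)
  open import Data.List.Relation.Unary.All using (All; []; _∷_)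
  open import Data.List.Relation.Binary.Pointwise using ([]; _∷_; Pointwise-length)
  open import Data.List.Relation.Unary.AllPairs using ([]; _∷_)
  open import Data.List.Relation.Unary.Unique.Propositional using (Unique)
  import Data.List.Relation.Unary.Unique.Propositional.Properties as Unique
  open import Data.Product using (_×_; _,_; proj₁; proj₂; Σ-syntax)
  open import Function using (_∘_; Equivalence)
  open import Relation.Nullary.Decidable using (toWitness)
  open import Relation.Binary.PropositionalEquality hiding ([_])
  open UniqueLists using (Unique-concatMap⁺)
  open Compositions using (compositions; ∈-compositions⁻; ∈-compositions⁺; Unique-compositions; length-compositions≡F; length-concatMap)
  open Walks using (Walk; Walk-++⁺; Walk-++⁻; block; count1; count1-++; count1-block; Walk-slack≤; Walk-block⇒; Walk-block⇐; sum≤*length)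
  open IntegerBoxes using (InBox; ∈-box⁻; ∈-box⁺; Unique-box)

  Block : Set
  Block = ℕ × ℕ

  word : List Block → List Bool
  word []             = []
  word ((a , b) ∷ bs) = block a b ++ word bs

  ones : List Block → ℕ
  ones bs = sum (map proj₂ bs)

  count1-word : ∀ bs → count1 (word bs) ≡ ones bs
  count1-word []             = refl
  count1-word ((a , b) ∷ bs) = trans (count1-++ (block a b) (word bs)) (cong₂ ℕ._+_ (count1-block a b) (count1-word bs))

  private
    m≤n+o⇒m-n≤o : ∀ m n o → m ℕ.≤ n ℕ.+ o → + m ℤ.- + n ℤ.≤ + o
    m≤n+o⇒m-n≤o m n o m≤n+o = subst (+ m ℤ.- + n ℤ.≤_) (cancel (+ n) (+ o))
      (ℤ.+-monoˡ-≤ (- + n) (subst (+ m ℤ.≤_) (ℤ.pos-+ n o) (+≤+ m≤n+o)))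
      where
      cancel : ∀ n o → n ℤ.+ o ℤ.- n ≡ o
      cancel = solve-∀

    n≤m+o⇒-o≤m-n : ∀ m n o → n ℕ.≤ m ℕ.+ o → - + o ℤ.≤ + m ℤ.- + n
    n≤m+o⇒-o≤m-n m n o n≤m+o = subst₂ ℤ._≤_ (cancel₁ (+ n) (+ o)) (cancel₂ (+ m) (+ n) (+ o))
      (ℤ.+-monoˡ-≤ (- + n ℤ.- + o) (subst (+ n ℤ.≤_) (ℤ.pos-+ m o) (+≤+ n≤m+o)))
      where
      cancel₁ : ∀ n o → n ℤ.+ (- n ℤ.- o) ≡ - o
      cancel₁ = solve-∀
      cancel₂ : ∀ m n o → m ℤ.+ o ℤ.+ (- n ℤ.- o) ≡ m ℤ.- n
      cancel₂ = solve-∀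

    ≤-⊓ : ∀ {x y z w} t → x ℕ.≤ y ℕ.+ t ℕ.* z → x ℕ.≤ y ℕ.+ t ℕ.* w → x ℕ.≤ y ℕ.+ t ℕ.* (z ⊓ w)
    ≤-⊓ {x} {y} {z} {w} t p q = subst (x ℕ.≤_) (trans (sym (ℕ.+-distribˡ-⊓ y _ _)) (cong (y ℕ.+_) (sym (ℕ.*-distribˡ-⊓ t z w))))
      (ℕ.⊓-glb p q)

  -- The two bounds on a shift c = d′ - d come from the block itself and from the slack available
  -- before it (at most t A) or still needed after it (at most t B).
  shift-bounds : ∀ t {A B a b d d′ s} → d ℕ.≤ t ℕ.* A → d′ ℕ.≤ t ℕ.* B → d′ ℕ.+ t ℕ.* b ≡ d ℕ.+ s → s ℕ.≤ t ℕ.* (a ℕ.+ b) →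
    - + (t ℕ.* (b ⊓ A)) ℤ.≤ + d′ ℤ.- + d × + d′ ℤ.- + d ℤ.≤ + (t ℕ.* (a ⊓ B))
  shift-bounds t {A} {B} {a} {b} {d} {d′} {s} d≤ d′≤ d′≡ s≤ =
    n≤m+o⇒-o≤m-n d′ d _ (≤-⊓ t d≤d′+tb (ℕ.≤-trans d≤ (ℕ.m≤n+m _ d′))) ,
    m≤n+o⇒m-n≤o d′ d _ (≤-⊓ t d′≤d+ta (ℕ.≤-trans d′≤ (ℕ.m≤n+m _ d)))
    where
    d≤d′+tb : d ℕ.≤ d′ ℕ.+ t ℕ.* b
    d≤d′+tb = ℕ.≤-trans (ℕ.m≤m+n d s) (ℕ.≤-reflexive (sym d′≡))
    regroup : ∀ d t a b → d ℕ.+ t ℕ.* (a ℕ.+ b) ≡ d ℕ.+ t ℕ.* a ℕ.+ t ℕ.* b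
    regroup = ℕ-Solver.solve-∀
    d′≤d+ta : d′ ℕ.≤ d ℕ.+ t ℕ.* a
    d′≤d+ta = ℕ.+-cancelʳ-≤ (t ℕ.* b) d′ (d ℕ.+ t ℕ.* a)
      (ℕ.≤-trans (ℕ.≤-reflexive d′≡) (ℕ.≤-trans (ℕ.+-monoʳ-≤ d s≤) (ℕ.≤-reflexive (regroup d t a b))))

  module _ (t : ℕ) where

    -- The box -t v_j ≤ c_j ≤ t u_j of the theorem, when A further 0s precede the first block.
    bounds : ℕ → List Block → List (ℤ × ℤ)
    bounds A []             = []
    bounds A ((a , b) ∷ bs) = (- + (t ℕ.* (b ⊓ A)) , + (t ℕ.* (a ⊓ ones bs))) ∷ bounds (A ℕ.+ a) bs

    length-bounds : ∀ A bs → length (bounds A bs) ≡ length bs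
    length-bounds A []       = refl
    length-bounds A (_ ∷ bs) = cong suc (length-bounds _ bs)

    -- Weight vectors of the word whose block (a, b) has weight t b + c, i.e. changes the slack by c.
    blockProduct : List (Block × ℤ) → List (List ℕ)
    blockProduct []                   = [ [] ]
    blockProduct (((a , b) , c) ∷ ps) =
      concatMap (λ y → map (y ++_) (blockProduct ps)) (compositions t (a ℕ.+ b) (+ (t ℕ.* b) ℤ.+ c))

    shifts : List Block → List (List ℤ)
    shifts bs = filterᵇ (admissible (+ 0)) (box (bounds 0 bs))

    walks : List Block → List (List ℕ)
    walks bs = concatMap (λ cs → blockProduct (zip bs cs)) (shifts bs)

    private
      ∈-blockProduct⁻ : ∀ a b c ps {ys} → ys ∈ blockProduct (((a , b) , c) ∷ ps) →
        Σ[ y ∈ List ℕ ] Σ[ z ∈ List ℕ ] (ys ≡ y ++ z × y ∈ compositions t (a ℕ.+ b) (+ (t ℕ.* b) ℤ.+ c) × z ∈ blockProduct ps)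
      ∈-blockProduct⁻ a b c ps ys∈
        with y , y∈ , ys∈′ ← find (∈-concatMap⁻ (λ y → map (y ++_) (blockProduct ps))
                                    {xs = compositions t (a ℕ.+ b) (+ (t ℕ.* b) ℤ.+ c)} ys∈)
        with z , z∈ , refl ← ∈-map⁻ (y ++_) ys∈′
        = y , z , refl , y∈ , z∈

      ∈-blockProduct⁺ : ∀ a b c ps {y z} → y ∈ compositions t (a ℕ.+ b) (+ (t ℕ.* b) ℤ.+ c) → z ∈ blockProduct ps →
        y ++ z ∈ blockProduct (((a , b) , c) ∷ ps)
      ∈-blockProduct⁺ a b c ps y∈ z∈ =
        ∈-concatMap⁺ (λ y → map (y ++_) (blockProduct ps)) (lose y∈ (∈-map⁺ (_ ++_) z∈))

      admissible-∷⁻ : ∀ acc c cs → T (admissible acc (c ∷ cs)) → + 0 ℤ.≤ acc ℤ.+ c × T (admissible (acc ℤ.+ c) cs)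
      admissible-∷⁻ acc c cs adm with p , q ← Equivalence.to Bool.T-∧ adm = ℤ.≤ᵇ⇒≤ p , q

      admissible-∷⁺ : ∀ acc c cs → + 0 ℤ.≤ acc ℤ.+ c → T (admissible (acc ℤ.+ c) cs) → T (admissible acc (c ∷ cs))
      admissible-∷⁺ acc c cs p q = Equivalence.from Bool.T-∧ (ℤ.≤⇒≤ᵇ p , q)

      sum-shift : ∀ {d d′ b} ys → d′ ℕ.+ t ℕ.* b ≡ d ℕ.+ sum ys → + sum ys ≡ + (t ℕ.* b) ℤ.+ (+ d′ ℤ.- + d)
      sum-shift {d} {d′} {b} ys d′≡ = begin
        + sum ys                               ≡⟨ cancel (+ d) (+ sum ys) ⟨
        + d ℤ.+ + sum ys ℤ.- + d               ≡⟨ cong (ℤ._- + d) (ℤ.pos-+ d (sum ys)) ⟨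
        + (d ℕ.+ sum ys) ℤ.- + d               ≡⟨ cong (λ n → + n ℤ.- + d) d′≡ ⟨
        + (d′ ℕ.+ t ℕ.* b) ℤ.- + d             ≡⟨ cong (ℤ._- + d) (ℤ.pos-+ d′ (t ℕ.* b)) ⟩
        + d′ ℤ.+ + (t ℕ.* b) ℤ.- + d           ≡⟨ regroup (+ d′) (+ (t ℕ.* b)) (+ d) ⟩
        + (t ℕ.* b) ℤ.+ (+ d′ ℤ.- + d)         ∎
        where
        open ≡-Reasoning
        cancel : ∀ d s → d ℤ.+ s ℤ.- d ≡ s
        cancel = solve-∀
        regroup : ∀ d′ tb d → d′ ℤ.+ tb ℤ.- d ≡ tb ℤ.+ (d′ ℤ.- d)
        regroup = solve-∀

      shift-sum : ∀ {d d′ b c} ys → + sum ys ≡ + (t ℕ.* b) ℤ.+ c → + d′ ≡ + d ℤ.+ c → d′ ℕ.+ t ℕ.* b ≡ d ℕ.+ sum ys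
      shift-sum {d} {d′} {b} {c} ys sum≡ d′≡ = ℤ.+-injective (begin
        + (d′ ℕ.+ t ℕ.* b)           ≡⟨ ℤ.pos-+ d′ (t ℕ.* b) ⟩
        + d′ ℤ.+ + (t ℕ.* b)         ≡⟨ cong (ℤ._+ + (t ℕ.* b)) d′≡ ⟩
        + d ℤ.+ c ℤ.+ + (t ℕ.* b)    ≡⟨ regroup (+ d) c (+ (t ℕ.* b)) ⟩
        + d ℤ.+ (+ (t ℕ.* b) ℤ.+ c)  ≡⟨ cong (ℤ._+_ (+ d)) sum≡ ⟨
        + d ℤ.+ + sum ys             ≡⟨ ℤ.pos-+ d (sum ys) ⟨
        + (d ℕ.+ sum ys)             ∎)
        where
        open ≡-Reasoning
        regroup : ∀ d c tb → d ℤ.+ c ℤ.+ tb ≡ d ℤ.+ (tb ℤ.+ c)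
        regroup = solve-∀

    ∈-blockProduct⇒Walk : ∀ bs cs d ys → length cs ≡ length bs → T (admissible (+ d) cs) →
      ys ∈ blockProduct (zip bs cs) → Walk t d (word bs) ys 0
    ∈-blockProduct⇒Walk []             []       d .[] _   adm (here refl) = ℤ.+-injective (toWitness adm)
    ∈-blockProduct⇒Walk ((a , b) ∷ bs) (c ∷ cs) d ys  len adm ys∈
      with 0≤d′ , adm′ ← admissible-∷⁻ (+ d) c cs adm
      with y , z , refl , y∈ , z∈ ← ∈-blockProduct⁻ a b c (zip bs cs) ys∈
      with len-y , ≤t , sum≡ ← ∈-compositions⁻ t (a ℕ.+ b) _ y y∈ =
      Walk-++⁺ (block a b)
        (Walk-block⇐ t d a b y d′ len-y ≤t (shift-sum {c = c} y sum≡ d′≡))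
        (∈-blockProduct⇒Walk bs cs d′ z (ℕ.suc-injective len) (subst (T ∘ (λ acc → admissible acc cs)) (sym d′≡) adm′) z∈)
      where
      d′ : ℕ
      d′ = ℤ.∣ + d ℤ.+ c ∣
      d′≡ : + d′ ≡ + d ℤ.+ c
      d′≡ = ℤ.0≤i⇒+∣i∣≡i 0≤d′

    private
      block-sum≤ : ∀ a b y → length y ≡ a ℕ.+ b → All (ℕ._≤ t) y → sum y ℕ.≤ t ℕ.* (a ℕ.+ b)
      block-sum≤ a b y len-y ≤t = subst (λ n → sum y ℕ.≤ t ℕ.* n) len-y (sum≤*length t y ≤t)

      slack≤ : ∀ {A a b d d′ s} → d ℕ.≤ t ℕ.* A → d′ ℕ.+ t ℕ.* b ≡ d ℕ.+ s → s ℕ.≤ t ℕ.* (a ℕ.+ b) → d′ ℕ.≤ t ℕ.* (A ℕ.+ a)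
      slack≤ {A} {a} {b} {d} {d′} d≤ d′≡ s≤ = ℕ.+-cancelʳ-≤ (t ℕ.* b) d′ (t ℕ.* (A ℕ.+ a))
        (ℕ.≤-trans (ℕ.≤-reflexive d′≡) (ℕ.≤-trans (ℕ.+-mono-≤ d≤ s≤) (ℕ.≤-reflexive (regroup t A a b))))
        where
        regroup : ∀ t A a b → t ℕ.* A ℕ.+ t ℕ.* (a ℕ.+ b) ≡ t ℕ.* (A ℕ.+ a) ℕ.+ t ℕ.* b
        regroup = ℕ-Solver.solve-∀

    Walk⇒∈-blockProduct : ∀ bs A d ys → d ℕ.≤ t ℕ.* A → Walk t d (word bs) ys 0 →
      Σ[ cs ∈ List ℤ ] (InBox (bounds A bs) cs × T (admissible (+ d) cs) × ys ∈ blockProduct (zip bs cs))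
    Walk⇒∈-blockProduct []             A d []  _   refl = [] , [] , tt , here refl
    Walk⇒∈-blockProduct ((a , b) ∷ bs) A d ys d≤ h
      with y , z , d′ , refl , h₁ , h₂ ← Walk-++⁻ (block a b) ys h
      with len-y , ≤t , d′≡ ← Walk-block⇒ t d a b y d′ h₁
      with cs , inBox , adm , z∈ ← Walk⇒∈-blockProduct bs (A ℕ.+ a) d′ z (slack≤ {a = a} d≤ d′≡ (block-sum≤ a b y len-y ≤t)) h₂ =
      c ∷ cs , shift-bounds t d≤ d′≤ d′≡ (block-sum≤ a b y len-y ≤t) ∷ inBox ,
      admissible-∷⁺ (+ d) c cs (subst (+ 0 ℤ.≤_) (sym d+c) (+≤+ z≤n)) (subst (λ acc → T (admissible acc cs)) (sym d+c) adm) ,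
      ∈-blockProduct⁺ a b c (zip bs cs) (∈-compositions⁺ t (a ℕ.+ b) _ y len-y ≤t (sum-shift y d′≡)) z∈
      where
      c : ℤ
      c = + d′ ℤ.- + d
      cancel : ∀ d d′ → d ℤ.+ (d′ ℤ.- d) ≡ d′
      cancel = solve-∀
      d+c : + d ℤ.+ c ≡ + d′
      d+c = cancel (+ d) (+ d′)
      d′≤ : d′ ℕ.≤ t ℕ.* ones bs
      d′≤ = subst (λ n → d′ ℕ.≤ t ℕ.* n) (count1-word bs) (Walk-slack≤ t d′ (word bs) z h₂)

    shiftsOf : List Block → List ℕ → List ℤ
    shiftsOf []             ys = []
    shiftsOf ((a , b) ∷ bs) ys = (+ sum (take (a ℕ.+ b) ys) ℤ.- + (t ℕ.* b)) ∷ shiftsOf bs (drop (a ℕ.+ b) ys)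

    private
      take-++ : ∀ {A : Set} (y z : List A) {n} → length y ≡ n → take n (y ++ z) ≡ y
      take-++ []      z refl = refl
      take-++ (x ∷ y) z refl = cong (x ∷_) (take-++ y z refl)

      drop-++ : ∀ {A : Set} (y z : List A) {n} → length y ≡ n → drop n (y ++ z) ≡ z
      drop-++ []      z refl = refl
      drop-++ (x ∷ y) z refl = drop-++ y z refl

    shiftsOf-blockProduct : ∀ bs cs {ys} → length cs ≡ length bs → ys ∈ blockProduct (zip bs cs) → shiftsOf bs ys ≡ cs
    shiftsOf-blockProduct []             []       _   (here refl) = refl
    shiftsOf-blockProduct ((a , b) ∷ bs) (c ∷ cs) len ys∈
      with y , z , refl , y∈ , z∈ ← ∈-blockProduct⁻ a b c (zip bs cs) ys∈
      with len-y , _ , sum≡ ← ∈-compositions⁻ t (a ℕ.+ b) _ y y∈ =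
      cong₂ _∷_ shift≡ (trans (cong (shiftsOf bs) (drop-++ y z len-y)) (shiftsOf-blockProduct bs cs (ℕ.suc-injective len) z∈))
      where
      cancel : ∀ x c → x ℤ.+ c ℤ.- x ≡ c
      cancel = solve-∀
      shift≡ : + sum (take (a ℕ.+ b) (y ++ z)) ℤ.- + (t ℕ.* b) ≡ c
      shift≡ = trans (cong (λ w → + sum w ℤ.- + (t ℕ.* b)) (take-++ y z len-y))
                     (trans (cong (ℤ._- + (t ℕ.* b)) sum≡) (cancel (+ (t ℕ.* b)) c))

    Unique-blockProduct : ∀ ps → Unique (blockProduct ps)
    Unique-blockProduct []                   = [] ∷ []
    Unique-blockProduct (((a , b) , c) ∷ ps) =
      Unique-concatMap⁺ (λ y → map (y ++_) (blockProduct ps)) (Unique-compositions t (a ℕ.+ b) _)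
        (λ {y} _ → Unique.map⁺ (List.++-cancelˡ y _ _) (Unique-blockProduct ps))
        same-prefix
      where
      same-prefix : ∀ {y y′ z} → y ∈ compositions t (a ℕ.+ b) _ → y′ ∈ compositions t (a ℕ.+ b) _ →
        z ∈ map (y ++_) (blockProduct ps) → z ∈ map (y′ ++_) (blockProduct ps) → y ≡ y′
      same-prefix {y} {y′} y∈ y′∈ z∈ z∈′
        with w , _ , refl ← ∈-map⁻ (y ++_) z∈ | w′ , _ , z≡ ← ∈-map⁻ (y′ ++_) z∈′ =
        trans (sym (take-++ y w (proj₁ (∈-compositions⁻ t _ _ y y∈))))
              (trans (cong (take (a ℕ.+ b)) z≡) (take-++ y′ w′ (proj₁ (∈-compositions⁻ t _ _ y′ y′∈))))

    private
      ∈-shifts⁻ : ∀ bs {cs} → cs ∈ shifts bs → InBox (bounds 0 bs) cs × T (admissible (+ 0) cs)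
      ∈-shifts⁻ bs cs∈ with cs∈box , adm ← ∈-filter⁻ (Bool.T? ∘ admissible (+ 0)) {xs = box (bounds 0 bs)} cs∈ =
        ∈-box⁻ (bounds 0 bs) cs∈box , adm

      ∈-shifts⁺ : ∀ bs {cs} → InBox (bounds 0 bs) cs → T (admissible (+ 0) cs) → cs ∈ shifts bs
      ∈-shifts⁺ bs inBox adm = ∈-filter⁺ (Bool.T? ∘ admissible (+ 0)) {xs = box (bounds 0 bs)} (∈-box⁺ inBox) adm

      length-shifts : ∀ bs {cs} → cs ∈ shifts bs → length cs ≡ length bs
      length-shifts bs cs∈ = trans (sym (Pointwise-length (proj₁ (∈-shifts⁻ bs cs∈)))) (length-bounds 0 bs)

    Unique-walks : ∀ bs → Unique (walks bs)
    Unique-walks bs =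
      Unique-concatMap⁺ (λ cs → blockProduct (zip bs cs))
        (Unique.filter⁺ (Bool.T? ∘ admissible (+ 0)) (Unique-box (bounds 0 bs)))
        (λ {cs} _ → Unique-blockProduct (zip bs cs))
        (λ {cs} {cs′} cs∈ cs′∈ ys∈ ys∈′ →
           trans (sym (shiftsOf-blockProduct bs cs (length-shifts bs cs∈) ys∈)) (shiftsOf-blockProduct bs cs′ (length-shifts bs cs′∈) ys∈′))

    ∈-walks⁻ : ∀ bs {ys} → ys ∈ walks bs → Walk t 0 (word bs) ys 0
    ∈-walks⁻ bs ys∈
      with cs , cs∈ , ys∈′ ← find (∈-concatMap⁻ (λ cs → blockProduct (zip bs cs)) {xs = shifts bs} ys∈) =
      ∈-blockProduct⇒Walk bs cs 0 _ (length-shifts bs cs∈) (proj₂ (∈-shifts⁻ bs cs∈)) ys∈′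

    ∈-walks⁺ : ∀ bs {ys} → Walk t 0 (word bs) ys 0 → ys ∈ walks bs
    ∈-walks⁺ bs {ys} h with cs , inBox , adm , ys∈ ← Walk⇒∈-blockProduct bs 0 0 ys z≤n h =
      ∈-concatMap⁺ (λ cs → blockProduct (zip bs cs)) (lose (∈-shifts⁺ bs inBox adm) ys∈)

    blockF : Block × ℤ → ℤ
    blockF ((a , b) , c) = F a b c t

    private
      length-concatMap-++ : ∀ (K L : List (List ℕ)) → length (concatMap (λ y → map (y ++_) L) K) ≡ length K ℕ.* length L
      length-concatMap-++ []      L = refl
      length-concatMap-++ (y ∷ K) L =
        trans (List.length-++ (map (y ++_) L)) (cong₂ ℕ._+_ (List.length-map (y ++_) L) (length-concatMap-++ K L))

    length-blockProduct : ∀ bs cs → All (λ block → 0 ℕ.< proj₂ block) bs →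
      + length (blockProduct (zip bs cs)) ≡ prodℤ (map blockF (zip bs cs))
    length-blockProduct []             cs       _          = refl
    length-blockProduct (_ ∷ _)        []       _          = refl
    length-blockProduct ((a , b) ∷ bs) (c ∷ cs) (0<b ∷ 0<bs) = begin
      + length (blockProduct (((a , b) , c) ∷ zip bs cs))
        ≡⟨ cong +_ (length-concatMap-++ (compositions t (a ℕ.+ b) _) (blockProduct (zip bs cs))) ⟩
      + (length (compositions t (a ℕ.+ b) _) ℕ.* length (blockProduct (zip bs cs)))
        ≡⟨ ℤ.pos-* (length (compositions t (a ℕ.+ b) _)) _ ⟩
      + length (compositions t (a ℕ.+ b) (+ (t ℕ.* b) ℤ.+ c)) ℤ.* + length (blockProduct (zip bs cs))
        ≡⟨ cong₂ ℤ._*_ (length-compositions≡F t a b c 0<b) (length-blockProduct bs cs 0<bs) ⟩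
      prodℤ (map blockF (((a , b) , c) ∷ zip bs cs))
        ∎
      where open ≡-Reasoning

    blockRHS : List Block → ℤ
    blockRHS bs = sumℤ (map (λ cs → prodℤ (map blockF (zip bs cs))) (shifts bs))

    length-walks : ∀ bs → All (λ block → 0 ℕ.< proj₂ block) bs → + length (walks bs) ≡ blockRHS bs
    length-walks bs 0<bs = trans (length-concatMap (λ cs → blockProduct (zip bs cs)) (shifts bs))
      (cong sumℤ (List.map-cong (λ cs → length-blockProduct bs cs 0<bs) (shifts bs)))

module RunBlocks where

  open import Defs using (runWord; RHS; u; sumFinWhere; sumℤ; prodℤ; F; admissible; box)
  open import Data.Bool using (Bool; true; false; if_then_else_)
  open import Data.Nat as ℕ using (ℕ; zero; suc; _⊓_)
  import Data.Nat.Properties as ℕ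
  open import Data.Nat.ListAction using (sum)
  open import Data.Integer as ℤ using (ℤ; +_; -_)
  open import Data.Fin using (Fin; toℕ) renaming (zero to fzero; suc to fsuc)
  open import Data.List using (List; []; _∷_; _++_; map; concat; filterᵇ; allFin; foldr; zip)
  import Data.List.Properties as List
  open import Data.Product using (_×_; _,_)
  open import Function using (_∘_; id)
  open import Relation.Binary.PropositionalEquality
  open Walks using (block)
  open BlockEnumeration using (Block; word; ones; bounds; shifts; blockF; blockRHS)

  private
    map-allFin-suc : ∀ {A : Set} {m} (f : Fin (suc m) → A) → map f (allFin (suc m)) ≡ f fzero ∷ map (f ∘ fsuc) (allFin m)
    map-allFin-suc f = cong (f fzero ∷_) (trans (List.map-tabulate fsuc f) (sym (List.map-tabulate id (f ∘ fsuc))))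

    sum-map-filterᵇ : ∀ {A : Set} (P : A → Bool) (f : A → ℕ) xs →
      foldr ℕ._+_ 0 (map f (filterᵇ P xs)) ≡ sum (map (λ i → if P i then f i else 0) xs)
    sum-map-filterᵇ P f []       = refl
    sum-map-filterᵇ P f (x ∷ xs) with P x
    ... | true  = cong (f x ℕ.+_) (sum-map-filterᵇ P f xs)
    ... | false = sum-map-filterᵇ P f xs

  sumFinWhere-suc : ∀ {m} (P : Fin (suc m) → Bool) (f : Fin (suc m) → ℕ) →
    sumFinWhere P f ≡ (if P fzero then f fzero else 0) ℕ.+ sumFinWhere (P ∘ fsuc) (f ∘ fsuc)
  sumFinWhere-suc {m} P f = begin
    sumFinWhere P f                                       ≡⟨ sum-map-filterᵇ P f (allFin (suc m)) ⟩
    sum (map g (allFin (suc m)))                          ≡⟨ cong sum (map-allFin-suc g) ⟩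
    g fzero ℕ.+ sum (map (g ∘ fsuc) (allFin m))           ≡⟨ cong (g fzero ℕ.+_) (sum-map-filterᵇ (P ∘ fsuc) (f ∘ fsuc) (allFin m)) ⟨
    g fzero ℕ.+ sumFinWhere (P ∘ fsuc) (f ∘ fsuc)         ∎
    where
    open ≡-Reasoning
    g : Fin (suc m) → ℕ
    g i = if P i then f i else 0

  sumFinWhere-false : ∀ m (f : Fin m → ℕ) → sumFinWhere (λ _ → false) f ≡ 0
  sumFinWhere-false zero    f = refl
  sumFinWhere-false (suc m) f = trans (sumFinWhere-suc (λ _ → false) f) (sumFinWhere-false m (f ∘ fsuc))

  blocksOf : ∀ {m} → (Fin m → ℕ) → (Fin m → ℕ) → List Block
  blocksOf {m} a b = map (λ i → a i , b i) (allFin m)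

  blocksOf-suc : ∀ {m} (a b : Fin (suc m) → ℕ) → blocksOf a b ≡ (a fzero , b fzero) ∷ blocksOf (a ∘ fsuc) (b ∘ fsuc)
  blocksOf-suc a b = map-allFin-suc (λ i → a i , b i)

  ones-blocksOf : ∀ m (a b : Fin m → ℕ) → ones (blocksOf a b) ≡ sumFinWhere (λ _ → true) b
  ones-blocksOf zero    a b = refl
  ones-blocksOf (suc m) a b = begin
    ones (blocksOf a b)                                     ≡⟨ cong ones (blocksOf-suc a b) ⟩
    b fzero ℕ.+ ones (blocksOf (a ∘ fsuc) (b ∘ fsuc))       ≡⟨ cong (b fzero ℕ.+_) (ones-blocksOf m (a ∘ fsuc) (b ∘ fsuc)) ⟩
    b fzero ℕ.+ sumFinWhere (λ _ → true) (b ∘ fsuc)         ≡⟨ sumFinWhere-suc (λ _ → true) b ⟨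
    sumFinWhere (λ _ → true) b                              ∎
    where open ≡-Reasoning

  word-blocksOf : ∀ {m} (a b : Fin m → ℕ) → runWord a b ≡ word (blocksOf a b)
  word-blocksOf {m} a b = go (allFin m)
    where
    go : ∀ xs → concat (map (λ i → block (a i) (b i)) xs) ≡ word (map (λ i → a i , b i) xs)
    go []       = refl
    go (x ∷ xs) = cong (block (a x) (b x) ++_) (go xs)

  module _ (t : ℕ) where

    boundsFrom : ∀ {m} → ℕ → (a b : Fin m → ℕ) → List (ℤ × ℤ)
    boundsFrom {m} A a b =
      map (λ i → - + (t ℕ.* (b i ⊓ (A ℕ.+ sumFinWhere (λ j → toℕ j ℕ.<ᵇ toℕ i) a))) , + (t ℕ.* u a b i)) (allFin m)

    boundsFrom≡bounds : ∀ m A (a b : Fin m → ℕ) → boundsFrom A a b ≡ bounds t A (blocksOf a b)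
    boundsFrom≡bounds zero    A a b = refl
    boundsFrom≡bounds (suc m) A a b = begin
      boundsFrom A a b
        ≡⟨ map-allFin-suc _ ⟩
      g fzero ∷ map (g ∘ fsuc) (allFin m)
        ≡⟨ cong₂ _∷_ head≡ (trans (List.map-cong tail≡ (allFin m)) (boundsFrom≡bounds m (A ℕ.+ a fzero) (a ∘ fsuc) (b ∘ fsuc))) ⟩
      bounds t A ((a fzero , b fzero) ∷ blocksOf (a ∘ fsuc) (b ∘ fsuc))
        ≡⟨ cong (bounds t A) (blocksOf-suc a b) ⟨
      bounds t A (blocksOf a b)
        ∎
      where
      open ≡-Reasoning
      g : Fin (suc m) → ℤ × ℤ
      g i = - + (t ℕ.* (b i ⊓ (A ℕ.+ sumFinWhere (λ j → toℕ j ℕ.<ᵇ toℕ i) a))) , + (t ℕ.* u a b i)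
      bound : ℕ → ℕ → ℕ → ℕ → ℤ × ℤ
      bound a b A B = - + (t ℕ.* (b ⊓ A)) , + (t ℕ.* (a ⊓ B))
      head≡ : g fzero ≡ bound (a fzero) (b fzero) A (ones (blocksOf (a ∘ fsuc) (b ∘ fsuc)))
      head≡ = cong₂ (bound (a fzero) (b fzero))
        (trans (cong (A ℕ.+_) (trans (sumFinWhere-suc (λ j → toℕ j ℕ.<ᵇ 0) a) (sumFinWhere-false m (a ∘ fsuc)))) (ℕ.+-identityʳ A))
        (trans (sumFinWhere-suc (λ j → 0 ℕ.<ᵇ toℕ j) b) (sym (ones-blocksOf m (a ∘ fsuc) (b ∘ fsuc))))
      tail≡ : ∀ i → g (fsuc i) ≡ bound (a (fsuc i)) (b (fsuc i))
        (A ℕ.+ a fzero ℕ.+ sumFinWhere (λ j → toℕ j ℕ.<ᵇ toℕ i) (a ∘ fsuc)) (sumFinWhere (λ j → toℕ i ℕ.<ᵇ toℕ j) (b ∘ fsuc))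
      tail≡ i = cong₂ (bound (a (fsuc i)) (b (fsuc i)))
        (trans (cong (A ℕ.+_) (sumFinWhere-suc (λ j → toℕ j ℕ.<ᵇ suc (toℕ i)) a)) (sym (ℕ.+-assoc A (a fzero) _)))
        (sumFinWhere-suc (λ j → suc (toℕ i) ℕ.<ᵇ toℕ j) b)

    RHS≡blockRHS : ∀ {m} (a b : Fin m → ℕ) → RHS a b t ≡ blockRHS t (blocksOf a b)
    RHS≡blockRHS {m} a b = begin
      RHS a b t
        ≡⟨ cong (λ bs → sumℤ (map (λ cs → prodℤ (map Fᵢ (zip (allFin m) cs))) (filterᵇ (admissible (+ 0)) (box bs))))
                (boundsFrom≡bounds m 0 a b) ⟩
      sumℤ (map (λ cs → prodℤ (map Fᵢ (zip (allFin m) cs))) (shifts t (blocksOf a b)))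
        ≡⟨ cong sumℤ (List.map-cong (λ cs → cong prodℤ (zip-blocks (allFin m) cs)) (shifts t (blocksOf a b))) ⟩
      blockRHS t (blocksOf a b)
        ∎
      where
      open ≡-Reasoning
      Fᵢ : Fin m × ℤ → ℤ
      Fᵢ (i , c) = F (a i) (b i) c t
      zip-blocks : ∀ xs cs → map Fᵢ (zip xs cs) ≡ map (blockF t) (zip (map (λ i → a i , b i) xs) cs)
      zip-blocks []       cs       = refl
      zip-blocks (x ∷ xs) []       = refl
      zip-blocks (x ∷ xs) (c ∷ cs) = cong (F (a x) (b x) c t ∷_) (zip-blocks xs cs)

module Bases where

  open import Defs using (elems; IsSMBasis)
  open import Data.Bool using (Bool; true; false)
  open import Data.Nat using (ℕ; zero; suc; _+_; _∸_; _≤_; z≤n; s≤s; s≤s⁻¹)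
  open import Data.Nat.Properties using (≤-trans; ≤-reflexive; 1+n≰n)
  open import Data.List using (List; []; _∷_; [_]; _++_; map; length; replicate)
  open import Data.List.Properties using (length-++; length-replicate; ++-assoc)
  open import Data.List.Relation.Binary.Pointwise as Pointwise using (Pointwise; []; _∷_; Pointwise-length)
  open import Data.List.Relation.Unary.All using (All; []; _∷_)
  open import Data.Vec using (Vec; []; _∷_; toList)
  import Data.Vec as Vec
  open import Data.Product using (_,_)
  open import Data.Empty using (⊥-elim)
  open import Relation.Nullary using (¬_)
  open import Relation.Binary.PropositionalEquality hiding ([_])
  open Walks using (Walk)

  bit : Bool → ℕ
  bit true  = 1
  bit false = 0

  bit≤1 : ∀ β → bit β ≤ 1
  bit≤1 true  = s≤s z≤n
  bit≤1 false = z≤n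

  bits : ∀ {n} → Vec Bool n → List ℕ
  bits T = toList (Vec.map bit T)

  private
    _≼_ : List ℕ → List ℕ → Set
    _≼_ = Pointwise _≤_

    ≼-suc⁻ : ∀ xs ys → map suc xs ≼ map suc ys → xs ≼ ys
    ≼-suc⁻ xs ys p = Pointwise.map s≤s⁻¹ (Pointwise.map⁻ suc suc p)

    ≼-suc⁺ : ∀ xs ys → xs ≼ ys → map suc xs ≼ map suc ys
    ≼-suc⁺ xs ys p = Pointwise.map⁺ suc suc (Pointwise.map s≤s p)

    -- Entries of Z that are at most 1 compare with the shifted list exactly as zeros do.
    ≼-shift⁻ : ∀ Z {k} → All (_≤ 1) Z → length Z ≡ k → ∀ xs ys → (Z ++ map suc xs) ≼ map suc ys → (replicate k 0 ++ xs) ≼ ys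
    ≼-shift⁻ []      []        refl xs ys       p       = ≼-suc⁻ xs ys p
    ≼-shift⁻ (_ ∷ Z) (_ ∷ ≤1) refl xs (_ ∷ ys) (_ ∷ p) = z≤n ∷ ≼-shift⁻ Z ≤1 refl xs ys p

    ≼-shift⁺ : ∀ Z {k} → All (_≤ 1) Z → length Z ≡ k → ∀ xs ys → (replicate k 0 ++ xs) ≼ ys → (Z ++ map suc xs) ≼ map suc ys
    ≼-shift⁺ []      []         refl xs ys       p       = ≼-suc⁺ xs ys p
    ≼-shift⁺ (_ ∷ Z) (z≤1 ∷ ≤1) refl xs (_ ∷ ys) (_ ∷ p) = ≤-trans z≤1 (s≤s z≤n) ∷ ≼-shift⁺ Z ≤1 refl xs ys p

    map-suc-positive : ∀ xs → All (1 ≤_) (map suc xs)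
    map-suc-positive []       = []
    map-suc-positive (x ∷ xs) = s≤s z≤n ∷ map-suc-positive xs

    elems-positive : ∀ {n} (T : Vec Bool n) → All (1 ≤_) (elems T)
    elems-positive []          = []
    elems-positive (true ∷ T)  = s≤s z≤n ∷ map-suc-positive (elems T)
    elems-positive (false ∷ T) = map-suc-positive (elems T)

    no-match : ∀ xs {ys} → All (1 ≤_) xs → ¬ (map suc xs ≼ (1 ∷ ys))
    no-match (x ∷ xs) (1≤x ∷ _) (s≤s x≤0 ∷ _) = 1+n≰n (≤-trans 1≤x x≤0)

    leading : Bool → List ℕ
    leading true  = [ 1 ]
    leading false = []

    -- The e elements of T already read but not yet matched by elements of S, and the next letter of T.
    pending : ℕ → Bool → List ℕ
    pending e β = replicate e 0 ++ leading β

    pending≤1 : ∀ e β → All (_≤ 1) (pending e β)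
    pending≤1 zero    true  = s≤s z≤n ∷ []
    pending≤1 zero    false = []
    pending≤1 (suc e) β     = z≤n ∷ pending≤1 e β

    length-pending : ∀ e β → length (pending e β) ≡ e + bit β
    length-pending e true  = trans (length-++ (replicate e 0)) (cong (_+ 1) (length-replicate e))
    length-pending e false = trans (length-++ (replicate e 0)) (cong (_+ 0) (length-replicate e))

    pending-elems : ∀ {n} e β (T : Vec Bool n) → replicate e 0 ++ elems (β ∷ T) ≡ pending e β ++ map suc (elems T)
    pending-elems e true  T = sym (++-assoc (replicate e 0) [ 1 ] _)
    pending-elems e false T = sym (++-assoc (replicate e 0) [] _)

  -- With e pending elements of T, the rest of T is dominated by the rest of S.
  Dominated : ∀ {n} → ℕ → Vec Bool n → Vec Bool n → Set
  Dominated e T S = (replicate e 0 ++ elems T) ≼ elems S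

  Dominated⇒Walk : ∀ {n} e (T S : Vec Bool n) → Dominated e T S → Walk 1 e (toList S) (bits T) 0
  Dominated⇒Walk zero [] [] [] = refl
  Dominated⇒Walk e (β ∷ T) (false ∷ S) p =
    bit≤1 β , Dominated⇒Walk (e + bit β) T S
      (≼-shift⁻ (pending e β) (pending≤1 e β) (length-pending e β) (elems T) (elems S)
        (subst (_≼ map suc (elems S)) (pending-elems e β T) p))
  Dominated⇒Walk e (β ∷ T) (true ∷ S) p with pending e β | pending≤1 e β | length-pending e β
                                          | subst (_≼ (1 ∷ map suc (elems S))) (pending-elems e β T) p
  ... | []    | _       | _   | q     = ⊥-elim (no-match (elems T) (elems-positive T) q)
  ... | z ∷ Z | _ ∷ ≤1 | len | _ ∷ q =
    bit≤1 β , ≤-trans (s≤s z≤n) (≤-reflexive len) ,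
    Dominated⇒Walk (e + bit β ∸ 1) T S (≼-shift⁻ Z ≤1 (cong (_∸ 1) len) (elems T) (elems S) q)

  Walk⇒Dominated : ∀ {n} e (T S : Vec Bool n) → Walk 1 e (toList S) (bits T) 0 → Dominated e T S
  Walk⇒Dominated zero    [] [] refl = []
  Walk⇒Dominated (suc e) [] [] ()
  Walk⇒Dominated e (β ∷ T) (false ∷ S) (_ , h) =
    subst (_≼ map suc (elems S)) (sym (pending-elems e β T))
      (≼-shift⁺ (pending e β) (pending≤1 e β) (length-pending e β) (elems T) (elems S) (Walk⇒Dominated (e + bit β) T S h))
  Walk⇒Dominated e (β ∷ T) (true ∷ S) (_ , 1≤ , h)
    with pending e β | pending≤1 e β | length-pending e β | pending-elems e β T
  ... | []    | _          | len | _  = ⊥-elim (1+n≰n (≤-trans 1≤ (≤-reflexive (sym len))))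
  ... | z ∷ Z | z≤1 ∷ ≤1 | len | eq =
    subst (_≼ (1 ∷ map suc (elems S))) (sym eq)
      (z≤1 ∷ ≼-shift⁺ Z ≤1 (cong (_∸ 1) len) (elems T) (elems S) (Walk⇒Dominated (e + bit β ∸ 1) T S h))

  IsSMBasis⇒Walk : ∀ {n} (S T : Vec Bool n) → IsSMBasis S T → Walk 1 0 (toList S) (bits T) 0
  IsSMBasis⇒Walk S T (_ , p) = Dominated⇒Walk 0 T S p

  Walk⇒IsSMBasis : ∀ {n} (S T : Vec Bool n) → Walk 1 0 (toList S) (bits T) 0 → IsSMBasis S T
  Walk⇒IsSMBasis S T h = let p = Walk⇒Dominated 0 T S h in Pointwise-length p , p

module Decomposition where

  open import Data.Bool using (Bool; true; false)
  open import Data.Nat using (ℕ; zero; suc; _+_; _*_; _∸_; _≤_; z≤n; s≤s; _/_)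
  open import Data.Nat.Properties
  open import Data.Nat.DivMod using (m<n⇒m/n≡0; m/n≡1+[m∸n]/n; /-monoˡ-≤; m<n*o⇒m/o<n)
  open import Data.Nat.Tactic.RingSolver using (solve-∀)
  open import Data.List using (List; []; _∷_; length)
  open import Data.List.Relation.Unary.All using (All; []; _∷_)
  open import Data.Vec using (Vec; []; _∷_; toList; lookup)
  open import Data.Fin using (Fin) renaming (zero to fzero; suc to fsuc)
  open import Data.Product using (_×_; _,_; proj₁; proj₂; Σ-syntax)
  open import Data.Sum using (inj₁; inj₂)
  open import Relation.Binary.PropositionalEquality
  open Walks using (Walk)
  open Bases using (bit; bit≤1; bits)

  module _ (t : ℕ) where

    opaque
      ⌈_⌉ : ℕ → ℕ
      ⌈ z ⌉ = (z + t) / suc t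

      ⌈0⌉ : ⌈ 0 ⌉ ≡ 0
      ⌈0⌉ = m<n⇒m/n≡0 (n<1+n t)

      ⌈+1+t⌉ : ∀ z → ⌈ z + suc t ⌉ ≡ suc ⌈ z ⌉
      ⌈+1+t⌉ z = begin
        (z + suc t + t) / suc t          ≡⟨ cong (_/ suc t) (swap z t) ⟩
        (z + t + suc t) / suc t          ≡⟨ m/n≡1+[m∸n]/n (m≤n+m (suc t) (z + t)) ⟩
        suc ((z + t + suc t ∸ suc t) / suc t) ≡⟨ cong (λ w → suc (w / suc t)) (m+n∸n≡m (z + t) (suc t)) ⟩
        suc ⌈ z ⌉                        ∎
        where
        open ≡-Reasoning
        swap : ∀ z t → z + suc t + t ≡ z + t + suc t
        swap = solve-∀

      ⌈⌉-mono : ∀ {z z′} → z ≤ z′ → ⌈ z ⌉ ≤ ⌈ z′ ⌉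
      ⌈⌉-mono z≤z′ = /-monoˡ-≤ (suc t) (+-monoˡ-≤ t z≤z′)

      ⌈⌉≤ : ∀ z → ⌈ z ⌉ ≤ z
      ⌈⌉≤ zero    = ≤-reflexive ⌈0⌉
      ⌈⌉≤ (suc z) = ≤-pred (m<n*o⇒m/o<n {suc z + t} {suc (suc z)} {suc t}
        (≤-trans (≤-reflexive (regroup z t)) (+-monoʳ-≤ (suc t) (m≤m*n (suc z) (suc t)))))
        where
        regroup : ∀ z t → suc (suc z + t) ≡ suc t + suc z
        regroup = solve-∀

    private
      ⌈⌉-step≤ : ∀ d y → y ≤ suc t → ⌈ d + y ⌉ ≤ suc ⌈ d ⌉
      ⌈⌉-step≤ d y y≤ = ≤-trans (⌈⌉-mono (+-monoʳ-≤ d y≤)) (≤-reflexive (⌈+1+t⌉ d))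

      ≤1⇒bit : ∀ n → n ≤ 1 → Σ[ β ∈ Bool ] bit β ≡ n
      ≤1⇒bit zero          _         = false , refl
      ≤1⇒bit (suc zero)    _         = true , refl
      ≤1⇒bit (suc (suc n)) (s≤s ())

      bit≤ : ∀ {d β} y → ⌈ d ⌉ + bit β ≡ ⌈ d + y ⌉ → bit β ≤ y
      bit≤ {β = β} (suc _) _ = ≤-trans (bit≤1 β) (s≤s z≤n)
      bit≤ {d} zero ⌈⌉+β = ≤-reflexive (+-cancelˡ-≡ ⌈ d ⌉ _ _ (trans ⌈⌉+β (trans (cong ⌈_⌉ (+-identityʳ d)) (sym (+-identityʳ ⌈ d ⌉)))))

      ∸bit≤ : ∀ {d β} y → y ≤ suc t → ⌈ d ⌉ + bit β ≡ ⌈ d + y ⌉ → y ∸ bit β ≤ t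
      ∸bit≤ {d} {β} y y≤ ⌈⌉+β with m≤n⇒m<n∨m≡n y≤
      ... | inj₁ (s≤s y≤t) = ≤-trans (m∸n≤m y (bit β)) y≤t
      ... | inj₂ refl      = ≤-reflexive (cong (suc t ∸_) β≡1)
        where
        β≡1 : bit β ≡ 1
        β≡1 = +-cancelˡ-≡ ⌈ d ⌉ _ _ (trans ⌈⌉+β (trans (⌈+1+t⌉ d) (+-comm 1 ⌈ d ⌉)))

    split : ∀ d y → y ≤ suc t →
      Σ[ β ∈ Bool ] (⌈ d ⌉ + bit β ≡ ⌈ d + y ⌉ × bit β ≤ y × y ∸ bit β ≤ t × (d ∸ ⌈ d ⌉) + (y ∸ bit β) ≡ (d + y) ∸ ⌈ d + y ⌉)
    split d y y≤ = β , ⌈⌉+β , bit≤y , y∸β≤t , slack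
      where
      ⌈d⌉≤ : ⌈ d ⌉ ≤ ⌈ d + y ⌉
      ⌈d⌉≤ = ⌈⌉-mono (m≤m+n d y)
      Δ≤1 : ⌈ d + y ⌉ ∸ ⌈ d ⌉ ≤ 1
      Δ≤1 = ≤-trans (∸-monoˡ-≤ ⌈ d ⌉ (⌈⌉-step≤ d y y≤)) (≤-reflexive (m+n∸n≡m 1 ⌈ d ⌉))
      β : Bool
      β = proj₁ (≤1⇒bit _ Δ≤1)
      ⌈⌉+β : ⌈ d ⌉ + bit β ≡ ⌈ d + y ⌉
      ⌈⌉+β = trans (cong (⌈ d ⌉ +_) (proj₂ (≤1⇒bit _ Δ≤1))) (m+[n∸m]≡n ⌈d⌉≤)
      bit≤y : bit β ≤ y
      bit≤y = bit≤ {d} {β} y ⌈⌉+β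
      y∸β≤t : y ∸ bit β ≤ t
      y∸β≤t = ∸bit≤ {d} {β} y y≤ ⌈⌉+β
      slack : (d ∸ ⌈ d ⌉) + (y ∸ bit β) ≡ (d + y) ∸ ⌈ d + y ⌉
      slack = begin
        (d ∸ ⌈ d ⌉) + (y ∸ bit β)                   ≡⟨ m+n∸n≡m _ (⌈ d ⌉ + bit β) ⟨
        (d ∸ ⌈ d ⌉) + (y ∸ bit β) + (⌈ d ⌉ + bit β) ∸ (⌈ d ⌉ + bit β) ≡⟨ cong (_∸ (⌈ d ⌉ + bit β)) (regroup (d ∸ ⌈ d ⌉) (y ∸ bit β) ⌈ d ⌉ (bit β)) ⟩
        ((d ∸ ⌈ d ⌉) + ⌈ d ⌉) + ((y ∸ bit β) + bit β) ∸ (⌈ d ⌉ + bit β) ≡⟨ cong₂ (λ p q → p + q ∸ (⌈ d ⌉ + bit β)) (m∸n+n≡m (⌈⌉≤ d)) (m∸n+n≡m bit≤y) ⟩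
        d + y ∸ (⌈ d ⌉ + bit β)                     ≡⟨ cong (d + y ∸_) ⌈⌉+β ⟩
        d + y ∸ ⌈ d + y ⌉                           ∎
        where
        open ≡-Reasoning
        regroup : ∀ p q r s → p + q + (r + s) ≡ (p + r) + (q + s)
        regroup = solve-∀

    -- The 0/1 walk is given the slack ⌈ d / (t + 1) ⌉ and the other walk the rest.
    peel : ∀ {n} d (S : Vec Bool n) (y : Vec ℕ n) → Walk (suc t) d (toList S) (toList y) 0 →
      Σ[ B ∈ Vec Bool n ] Σ[ y′ ∈ Vec ℕ n ]
        (Walk 1 ⌈ d ⌉ (toList S) (bits B) 0 × Walk t (d ∸ ⌈ d ⌉) (toList S) (toList y′) 0 ×
         (∀ i → lookup y i ≡ bit (lookup B i) + lookup y′ i))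
    peel d [] [] refl = [] , [] , ⌈0⌉ , 0∸n≡0 ⌈ 0 ⌉ , λ ()
    peel d (false ∷ S) (y ∷ ys) (y≤ , h)
      with β , ⌈⌉+β , β≤y , y′≤t , slack ← split d y y≤
      with B , y′ , h₁ , h₂ , y≡ ← peel (d + y) S ys h =
      β ∷ B , (y ∸ bit β) ∷ y′ ,
      (bit≤1 β , subst (λ e → Walk 1 e (toList S) (bits B) 0) (sym ⌈⌉+β) h₁) ,
      (y′≤t , subst (λ e → Walk t e (toList S) (toList y′) 0) (sym slack) h₂) ,
      λ { fzero → sym (m+[n∸m]≡n β≤y) ; (fsuc i) → y≡ i }
    peel d (true ∷ S) (y ∷ ys) (y≤ , t<d+y , h)
      with β , ⌈⌉+β , β≤y , y′≤t , slack ← split d y y≤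
      with B , y′ , h₁ , h₂ , y≡ ← peel (d + y ∸ suc t) S ys h =
      β ∷ B , (y ∸ bit β) ∷ y′ ,
      (bit≤1 β , subst (1 ≤_) (sym ⌈⌉+β′) (s≤s z≤n) , subst (λ e → Walk 1 e (toList S) (bits B) 0) (cong (_∸ 1) (sym ⌈⌉+β′)) h₁) ,
      (y′≤t , subst (t ≤_) (sym slack′) (m≤n+m t _) ,
       subst (λ e → Walk t e (toList S) (toList y′) 0) (sym (trans (cong (_∸ t) slack′) (m+n∸n≡m _ t))) h₂) ,
      λ { fzero → sym (m+[n∸m]≡n β≤y) ; (fsuc i) → y≡ i }
      where
      z : ℕ
      z = d + y ∸ suc t
      z+1+t : z + suc t ≡ d + y
      z+1+t = m∸n+n≡m t<d+y
      ⌈⌉+β′ : ⌈ d ⌉ + bit β ≡ suc ⌈ z ⌉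
      ⌈⌉+β′ = trans ⌈⌉+β (trans (cong ⌈_⌉ (sym z+1+t)) (⌈+1+t⌉ z))
      slack′ : (d ∸ ⌈ d ⌉) + (y ∸ bit β) ≡ (z ∸ ⌈ z ⌉) + t
      slack′ = trans slack (trans (cong₂ _∸_ (sym z+1+t) (trans (sym ⌈⌉+β) ⌈⌉+β′))
                                  (trans (cong (_∸ suc ⌈ z ⌉) (+-suc z t)) (+-∸-comm t (⌈⌉≤ z))))

  Walk⇒≤ : ∀ {n} t d (S : Vec Bool n) (y : Vec ℕ n) d′ → Walk t d (toList S) (toList y) d′ → ∀ i → lookup y i ≤ t
  Walk⇒≤ t d (false ∷ S) (y ∷ ys) d′ (y≤ , _)     fzero    = y≤
  Walk⇒≤ t d (true ∷ S)  (y ∷ ys) d′ (y≤ , _ , _) fzero    = y≤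
  Walk⇒≤ t d (false ∷ S) (y ∷ ys) d′ (_ , h)      (fsuc i) = Walk⇒≤ t _ S ys d′ h i
  Walk⇒≤ t d (true ∷ S)  (y ∷ ys) d′ (_ , _ , h)  (fsuc i) = Walk⇒≤ t _ S ys d′ h i

  multiplicity : ∀ {n} → Fin n → List (Vec Bool n) → ℕ
  multiplicity i []       = 0
  multiplicity i (B ∷ Bs) = bit (lookup B i) + multiplicity i Bs

  decompose : ∀ {n} t (S : Vec Bool n) (y : Vec ℕ n) → Walk t 0 (toList S) (toList y) 0 →
    Σ[ Bs ∈ List (Vec Bool n) ]
      (length Bs ≡ t × All (λ B → Walk 1 0 (toList S) (bits B) 0) Bs × (∀ i → lookup y i ≡ multiplicity i Bs))
  decompose zero S y h = [] , refl , [] , λ i → n≤0⇒n≡0 (Walk⇒≤ 0 0 S y 0 h i)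
  decompose (suc t) S y h
    with B , y′ , h₁ , h₂ , y≡ ← peel t 0 S y h
    with Bs , len , hs , y′≡ ← decompose t S y′ (subst (λ e → Walk t e (toList S) (toList y′) 0) (0∸n≡0 (⌈_⌉ t 0)) h₂)
    = B ∷ Bs , cong suc len , subst (λ e → Walk 1 e (toList S) (bits B) 0) (⌈0⌉ t) h₁ ∷ hs ,
      λ i → trans (y≡ i) (cong (bit (lookup B i) +_) (y′≡ i))

module Rationals where

  open import Defs using (ℤ→ℚ; ℕ→ℚ; sumℚ)
  open import Level using (0ℓ)
  open import Data.Nat as ℕ using (ℕ; suc)
  import Data.Nat.Properties as ℕ
  open import Data.Integer as ℤ using (ℤ; +_)
  import Data.Integer.Properties as ℤ
  open import Data.Integer.Tactic.RingSolver using (solve-∀)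
  open import Data.Rational as ℚ using (ℚ; 0ℚ; 1ℚ; toℚᵘ; _+_; _*_; _-_; -_; _≤_)
  open import Data.Rational.Properties
  open import Data.Rational.Unnormalised as ℚᵘ using (mkℚᵘ; *≡*; *≤*)
  import Data.Rational.Unnormalised.Properties as ℚᵘ
  open import Data.List using (List; []; _∷_; map; length)
  import Data.List.Properties as List
  open import Data.List.Relation.Unary.All using (All; []; _∷_)
  open import Data.Maybe using (Maybe; just; nothing)
  open import Relation.Nullary using (yes; no)
  open import Function using (_∘_)
  open import Relation.Binary.PropositionalEquality
  import Tactic.RingSolver.Core.AlmostCommutativeRing as ACR
  import Tactic.RingSolver as ℚ-Solver

  ℚ-ring : ACR.AlmostCommutativeRing 0ℓ 0ℓ
  ℚ-ring = ACR.fromCommutativeRing +-*-commutativeRing is-0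
    where
    is-0 : ∀ x → Maybe (0ℚ ≡ x)
    is-0 x with 0ℚ ℚ.≟ x
    ... | yes p = just p
    ... | no _  = nothing

  private
    toℚᵘ-ℤ→ℚ : ∀ z → toℚᵘ (ℤ→ℚ z) ℚᵘ.≃ mkℚᵘ z 0
    toℚᵘ-ℤ→ℚ z = toℚᵘ-fromℚᵘ (mkℚᵘ z 0)

  ℤ→ℚ-+ : ∀ a b → ℤ→ℚ (a ℤ.+ b) ≡ ℤ→ℚ a + ℤ→ℚ b
  ℤ→ℚ-+ a b = toℚᵘ-injective (begin
    toℚᵘ (ℤ→ℚ (a ℤ.+ b))                ≈⟨ toℚᵘ-ℤ→ℚ (a ℤ.+ b) ⟩
    mkℚᵘ (a ℤ.+ b) 0                    ≈⟨ *≡* (denominators a b) ⟩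
    mkℚᵘ a 0 ℚᵘ.+ mkℚᵘ b 0              ≈⟨ ℚᵘ.+-cong (ℚᵘ.≃-sym (toℚᵘ-ℤ→ℚ a)) (ℚᵘ.≃-sym (toℚᵘ-ℤ→ℚ b)) ⟩
    toℚᵘ (ℤ→ℚ a) ℚᵘ.+ toℚᵘ (ℤ→ℚ b)      ≈⟨ ℚᵘ.≃-sym (toℚᵘ-homo-+ (ℤ→ℚ a) (ℤ→ℚ b)) ⟩
    toℚᵘ (ℤ→ℚ a + ℤ→ℚ b)                ∎)
    where
    open ℚᵘ.≃-Reasoning
    denominators : ∀ a b → (a ℤ.+ b) ℤ.* + 1 ≡ (a ℤ.* + 1 ℤ.+ b ℤ.* + 1) ℤ.* + 1
    denominators = solve-∀

  ℤ→ℚ-mono-≤ : ∀ {a b} → a ℤ.≤ b → ℤ→ℚ a ≤ ℤ→ℚ b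
  ℤ→ℚ-mono-≤ {a} {b} a≤b = toℚᵘ-cancel-≤ (ℚᵘ.≤-respˡ-≃ (ℚᵘ.≃-sym (toℚᵘ-ℤ→ℚ a)) (ℚᵘ.≤-respʳ-≃ (ℚᵘ.≃-sym (toℚᵘ-ℤ→ℚ b))
    (*≤* (subst₂ ℤ._≤_ (sym (ℤ.*-identityʳ a)) (sym (ℤ.*-identityʳ b)) a≤b))))

  ℤ→ℚ-cancel-≤ : ∀ {a b} → ℤ→ℚ a ≤ ℤ→ℚ b → a ℤ.≤ b
  ℤ→ℚ-cancel-≤ {a} {b} p with *≤* q ← ℚᵘ.≤-respˡ-≃ (toℚᵘ-ℤ→ℚ a) (ℚᵘ.≤-respʳ-≃ (toℚᵘ-ℤ→ℚ b) (toℚᵘ-mono-≤ p)) =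
    subst₂ ℤ._≤_ (ℤ.*-identityʳ a) (ℤ.*-identityʳ b) q

  ℤ→ℚ-injective : ∀ {a b} → ℤ→ℚ a ≡ ℤ→ℚ b → a ≡ b
  ℤ→ℚ-injective eq = ℤ.≤-antisym (ℤ→ℚ-cancel-≤ (≤-reflexive eq)) (ℤ→ℚ-cancel-≤ (≤-reflexive (sym eq)))

  ℕ→ℚ-+ : ∀ m n → ℕ→ℚ (m ℕ.+ n) ≡ ℕ→ℚ m + ℕ→ℚ n
  ℕ→ℚ-+ m n = trans (cong ℤ→ℚ (ℤ.pos-+ m n)) (ℤ→ℚ-+ (+ m) (+ n))

  ℕ→ℚ-∸ : ∀ {m n} → n ℕ.≤ m → ℕ→ℚ (m ℕ.∸ n) ≡ ℕ→ℚ m - ℕ→ℚ n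
  ℕ→ℚ-∸ {m} {n} n≤m = begin
    ℕ→ℚ (m ℕ.∸ n)                       ≡⟨ cancel (ℕ→ℚ (m ℕ.∸ n)) (ℕ→ℚ n) ⟨
    ℕ→ℚ (m ℕ.∸ n) + ℕ→ℚ n - ℕ→ℚ n       ≡⟨ cong (_- ℕ→ℚ n) (ℕ→ℚ-+ (m ℕ.∸ n) n) ⟨
    ℕ→ℚ (m ℕ.∸ n ℕ.+ n) - ℕ→ℚ n         ≡⟨ cong (λ k → ℕ→ℚ k - ℕ→ℚ n) (ℕ.m∸n+n≡m n≤m) ⟩
    ℕ→ℚ m - ℕ→ℚ n                       ∎
    where
    open ≡-Reasoning
    cancel : ∀ a b → a + b - b ≡ a
    cancel = ℚ-Solver.solve-∀ ℚ-ring

  ℕ→ℚ-nonNeg : ∀ n → 0ℚ ≤ ℕ→ℚ n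
  ℕ→ℚ-nonNeg n = ℤ→ℚ-mono-≤ {+ 0} {+ n} (ℤ.+≤+ ℕ.z≤n)

  ℕ→ℚ-cancel-≤ : ∀ {m n} → ℕ→ℚ m ≤ ℕ→ℚ n → m ℕ.≤ n
  ℕ→ℚ-cancel-≤ {m} {n} p with ℤ.+≤+ q ← ℤ→ℚ-cancel-≤ {+ m} {+ n} p = q

  ℕ→ℚ-injective : ∀ {m n} → ℕ→ℚ m ≡ ℕ→ℚ n → m ≡ n
  ℕ→ℚ-injective eq = ℤ.+-injective (ℤ→ℚ-injective eq)

  1/[1+_] : ℕ → ℚ
  1/[1+ t ] = + 1 ℚ./ suc t

  1/[1+]-nonNeg : ∀ t → 0ℚ ≤ 1/[1+ t ]
  1/[1+]-nonNeg t = toℚᵘ-cancel-≤ (ℚᵘ.≤-respʳ-≃ (ℚᵘ.≃-sym (toℚᵘ-fromℚᵘ (mkℚᵘ (+ 1) t))) (*≤* (ℤ.+≤+ ℕ.z≤n)))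

  [1+t]*1/[1+t] : ∀ t → ℕ→ℚ (suc t) * 1/[1+ t ] ≡ 1ℚ
  [1+t]*1/[1+t] t = toℚᵘ-injective (begin
    toℚᵘ (ℕ→ℚ (suc t) * 1/[1+ t ])           ≈⟨ toℚᵘ-homo-* (ℕ→ℚ (suc t)) 1/[1+ t ] ⟩
    toℚᵘ (ℕ→ℚ (suc t)) ℚᵘ.* toℚᵘ 1/[1+ t ]   ≈⟨ ℚᵘ.*-cong (toℚᵘ-ℤ→ℚ (+ suc t)) (toℚᵘ-fromℚᵘ (mkℚᵘ (+ 1) t)) ⟩
    mkℚᵘ (+ suc t) 0 ℚᵘ.* mkℚᵘ (+ 1) t        ≈⟨ *≡* (cross (+ suc t)) ⟩
    mkℚᵘ (+ 1) 0                              ≈⟨ ℚᵘ.≃-sym (toℚᵘ-ℤ→ℚ (+ 1)) ⟩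
    toℚᵘ 1ℚ                                   ∎)
    where
    open ℚᵘ.≃-Reasoning
    cross : ∀ T → T ℤ.* + 1 ℤ.* + 1 ≡ + 1 ℤ.* (+ 1 ℤ.* T)
    cross = solve-∀

  *-monoˡ-≤-0≤ : ∀ r {p q} → 0ℚ ≤ r → p ≤ q → r * p ≤ r * q
  *-monoˡ-≤-0≤ r 0≤r = *-monoˡ-≤-nonNeg r {{ℚ.nonNegative 0≤r}}

  *-nonNeg : ∀ {p q} → 0ℚ ≤ p → 0ℚ ≤ q → 0ℚ ≤ p * q
  *-nonNeg {p} 0≤p 0≤q = ≤-trans (≤-reflexive (sym (*-zeroʳ p))) (*-monoˡ-≤-0≤ p 0≤p 0≤q)

  module _ {X : Set} where

    Σℚ : List X → (X → ℚ) → ℚ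
    Σℚ xs f = sumℚ (map f xs)

    infix 5 Σℚ
    syntax Σℚ xs (λ x → e) = Σℚ[ x ∈ xs ] e

    Σℚ-cong-local : ∀ {xs} {f g : X → ℚ} → All (λ x → f x ≡ g x) xs → Σℚ xs f ≡ Σℚ xs g
    Σℚ-cong-local []         = refl
    Σℚ-cong-local (eq ∷ eqs) = cong₂ _+_ eq (Σℚ-cong-local eqs)

    Σℚ-cong : ∀ xs {f g : X → ℚ} → (∀ x → f x ≡ g x) → Σℚ xs f ≡ Σℚ xs g
    Σℚ-cong xs eq = cong sumℚ (List.map-cong eq xs)

    Σℚ-mono : ∀ {xs} {f g : X → ℚ} → All (λ x → f x ≤ g x) xs → Σℚ xs f ≤ Σℚ xs g
    Σℚ-mono []       = ≤-refl
    Σℚ-mono (p ∷ ps) = +-mono-≤ p (Σℚ-mono ps)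

    Σℚ-distrib-+ : ∀ xs (f g : X → ℚ) → (Σℚ[ x ∈ xs ] f x + g x) ≡ Σℚ xs f + Σℚ xs g
    Σℚ-distrib-+ []       f g = sym (+-identityˡ 0ℚ)
    Σℚ-distrib-+ (x ∷ xs) f g = trans (cong (λ s → f x + g x + s) (Σℚ-distrib-+ xs f g)) (interchange (f x) (g x) (Σℚ xs f) (Σℚ xs g))
      where
      interchange : ∀ a b c d → a + b + (c + d) ≡ a + c + (b + d)
      interchange = ℚ-Solver.solve-∀ ℚ-ring

    Σℚ-neg : ∀ xs (f : X → ℚ) → (Σℚ[ x ∈ xs ] - f x) ≡ - Σℚ xs f
    Σℚ-neg []       f = refl
    Σℚ-neg (x ∷ xs) f = trans (cong (λ s → - f x + s) (Σℚ-neg xs f)) (sym (neg-distrib-+ (f x) (Σℚ xs f)))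

    Σℚ-zero : ∀ {xs} {f : X → ℚ} → All (λ x → f x ≡ 0ℚ) xs → Σℚ xs f ≡ 0ℚ
    Σℚ-zero []         = refl
    Σℚ-zero (eq ∷ eqs) = trans (cong₂ _+_ eq (Σℚ-zero eqs)) (+-identityˡ 0ℚ)

    Σℚ-const : ∀ xs q → (Σℚ[ x ∈ xs ] q) ≡ ℕ→ℚ (length xs) * q
    Σℚ-const []       q = sym (*-zeroˡ q)
    Σℚ-const (x ∷ xs) q = begin
      q + Σℚ xs (λ _ → q)                    ≡⟨ cong (_+_ q) (Σℚ-const xs q) ⟩
      q + ℕ→ℚ (length xs) * q                ≡⟨ cong (_+ ℕ→ℚ (length xs) * q) (*-identityˡ q) ⟨
      1ℚ * q + ℕ→ℚ (length xs) * q           ≡⟨ *-distribʳ-+ q 1ℚ (ℕ→ℚ (length xs)) ⟨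
      (1ℚ + ℕ→ℚ (length xs)) * q             ≡⟨ cong (_* q) (ℕ→ℚ-+ 1 (length xs)) ⟨
      ℕ→ℚ (suc (length xs)) * q              ∎
      where open ≡-Reasoning

  Σℚ-map : ∀ {X Y : Set} (h : X → Y) xs (f : Y → ℚ) → Σℚ (map h xs) f ≡ Σℚ xs (f ∘ h)
  Σℚ-map h xs f = cong sumℚ (sym (List.map-∘ xs))

module Convexity where

  open import Defs using (ℤ→ℚ; ℕ→ℚ)
  open import Data.Bool using (Bool; true; false)
  open import Data.Nat as ℕ using (ℕ; suc)
  import Data.Nat.Properties as ℕ
  open import Data.Integer as ℤ using (ℤ; +_)
  import Data.Integer.Properties as ℤ
  open import Data.Rational as ℚ using (ℚ; 0ℚ; 1ℚ; _+_; _*_; _-_; -_; _≤_)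
  open import Data.Rational.Properties
  open import Data.List using (List; []; _∷_; map)
  open import Data.List.Relation.Unary.All as All using (All; []; _∷_)
  import Data.List.Relation.Unary.All.Properties as All
  open import Data.Vec using (Vec; []; _∷_; toList; lookup; tail)
  import Data.Vec as Vec
  open import Data.Fin using () renaming (zero to fzero; suc to fsuc)
  open import Data.Product using (_×_; _,_; proj₁; proj₂; Σ-syntax)
  open import Function using (_∘_)
  open import Relation.Binary.PropositionalEquality
  import Tactic.RingSolver as ℚ-Solver
  open Walks using (Walk)
  open Bases using (bit; bit≤1; bits)
  open Rationals

  record Term (n : ℕ) : Set where
    constructor term
    field
      weight : ℚ
      slack  : ℕ
      basis  : Vec Bool n

  open Term

  record IsCombination {n} (t d : ℕ) (S : Vec Bool n) (x : Vec ℤ n) (τs : List (Term n)) : Set where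
    field
      walks    : All (λ τ → Walk 1 (slack τ) (toList S) (bits (basis τ)) 0) τs
      nonNeg   : All (λ τ → 0ℚ ≤ weight τ) τs
      total    : Σℚ τs weight ≡ 1ℚ
      slack≡   : ℕ→ℚ d ≡ ℕ→ℚ t * (Σℚ[ τ ∈ τs ] weight τ * ℕ→ℚ (slack τ))
      lookup≡  : ∀ i → ℤ→ℚ (lookup x i) ≡ ℕ→ℚ t * (Σℚ[ τ ∈ τs ] weight τ * ℕ→ℚ (bit (lookup (basis τ) i)))

  open IsCombination

  private
    lookup-tail : ∀ {A : Set} {n} (B : Vec A (suc n)) i → lookup B (fsuc i) ≡ lookup (tail B) i
    lookup-tail (_ ∷ _) i = refl

    ℤ→ℚ≡t*q⇒≤t : ∀ t {x q} → ℤ→ℚ x ≡ ℕ→ℚ t * q → 0ℚ ≤ q → q ≤ 1ℚ → Σ[ y ∈ ℕ ] (x ≡ + y × y ℕ.≤ t)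
    ℤ→ℚ≡t*q⇒≤t t {x} {q} x≡tq 0≤q q≤1 = ℤ.∣ x ∣ , sym x≡y , ℕ→ℚ-cancel-≤ (begin
      ℕ→ℚ ℤ.∣ x ∣     ≡⟨ cong ℤ→ℚ x≡y ⟩
      ℤ→ℚ x            ≡⟨ x≡tq ⟩
      ℕ→ℚ t * q        ≤⟨ *-monoˡ-≤-0≤ (ℕ→ℚ t) (ℕ→ℚ-nonNeg t) q≤1 ⟩
      ℕ→ℚ t * 1ℚ       ≡⟨ *-identityʳ (ℕ→ℚ t) ⟩
      ℕ→ℚ t            ∎)
      where
      open ≤-Reasoning
      0≤x : + 0 ℤ.≤ x
      0≤x = ℤ→ℚ-cancel-≤ (≤-trans (≤-reflexive (sym (*-zeroʳ (ℕ→ℚ t))))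
              (≤-trans (*-monoˡ-≤-0≤ (ℕ→ℚ t) (ℕ→ℚ-nonNeg t) 0≤q) (≤-reflexive (sym x≡tq))))
      x≡y : + ℤ.∣ x ∣ ≡ x
      x≡y = ℤ.0≤i⇒+∣i∣≡i 0≤x

    weighted-nonNeg : ∀ {n} (τs : List (Term n)) (f : Term n → ℕ) → All (λ τ → 0ℚ ≤ weight τ) τs →
      0ℚ ≤ Σℚ[ τ ∈ τs ] weight τ * ℕ→ℚ (f τ)
    weighted-nonNeg τs f 0≤ = ≤-trans (≤-reflexive (sym (Σℚ-zero (All.universal (λ _ → refl) τs))))
      (Σℚ-mono (All.map (λ {τ} 0≤w → *-nonNeg 0≤w (ℕ→ℚ-nonNeg (f τ))) 0≤))

    weighted-+ : ∀ {n} (τs : List (Term n)) (f : Term n → ℕ) →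
      (Σℚ[ τ ∈ τs ] weight τ * ℕ→ℚ (slack τ ℕ.+ f τ))
        ≡ (Σℚ[ τ ∈ τs ] weight τ * ℕ→ℚ (slack τ)) + (Σℚ[ τ ∈ τs ] weight τ * ℕ→ℚ (f τ))
    weighted-+ τs f = trans (Σℚ-cong τs (λ τ → trans (cong (weight τ *_) (ℕ→ℚ-+ (slack τ) (f τ)))
                                                      (*-distribˡ-+ (weight τ) _ _)))
                            (Σℚ-distrib-+ τs _ _)

    b₀ : ∀ {n} → Term (suc n) → ℕ
    b₀ τ = bit (lookup (basis τ) fzero)

    weighted-≤1 : ∀ {n} (τs : List (Term (suc n))) → All (λ τ → 0ℚ ≤ weight τ) τs → Σℚ τs weight ≡ 1ℚ →
      (Σℚ[ τ ∈ τs ] weight τ * ℕ→ℚ (b₀ τ)) ≤ 1ℚ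
    weighted-≤1 τs 0≤ total = ≤-trans
      (Σℚ-mono (All.map (λ {τ} 0≤w → ≤-trans (*-monoˡ-≤-0≤ (weight τ) 0≤w (ℤ→ℚ-mono-≤ (ℤ.+≤+ (bit≤1 (lookup (basis τ) fzero)))))
                                              (≤-reflexive (*-identityʳ (weight τ)))) 0≤))
      (≤-reflexive total)

    head-coordinate : ∀ {n} {t d s S x₀ x} {τs : List (Term (suc n))} → IsCombination t d (s ∷ S) (x₀ ∷ x) τs →
      Σ[ y₀ ∈ ℕ ] (x₀ ≡ + y₀ × y₀ ℕ.≤ t)
    head-coordinate {t = t} {τs = τs} c =
      ℤ→ℚ≡t*q⇒≤t t (lookup≡ c fzero) (weighted-nonNeg τs b₀ (nonNeg c)) (weighted-≤1 τs (nonNeg c) (total c))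

    head-slack : ∀ {n} {t d s S y₀ x} {τs : List (Term (suc n))} → IsCombination t d (s ∷ S) (+ y₀ ∷ x) τs →
      ℕ→ℚ (d ℕ.+ y₀) ≡ ℕ→ℚ t * (Σℚ[ τ ∈ τs ] weight τ * ℕ→ℚ (slack τ ℕ.+ b₀ τ))
    head-slack {t = t} {d} {y₀ = y₀} {τs = τs} c = begin
        ℕ→ℚ (d ℕ.+ y₀)                      ≡⟨ ℕ→ℚ-+ d y₀ ⟩
        ℕ→ℚ d + ℕ→ℚ y₀                      ≡⟨ cong₂ _+_ (slack≡ c) (lookup≡ c fzero) ⟩
        ℕ→ℚ t * E + ℕ→ℚ t * B               ≡⟨ *-distribˡ-+ (ℕ→ℚ t) E B ⟨
        ℕ→ℚ t * (E + B)                     ≡⟨ cong (ℕ→ℚ t *_) (weighted-+ τs b₀) ⟨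
        ℕ→ℚ t * (Σℚ[ τ ∈ τs ] weight τ * ℕ→ℚ (slack τ ℕ.+ b₀ τ)) ∎
      where
      open ≡-Reasoning
      E B : ℚ
      E = Σℚ[ τ ∈ τs ] weight τ * ℕ→ℚ (slack τ)
      B = Σℚ[ τ ∈ τs ] weight τ * ℕ→ℚ (b₀ τ)

    restrict : ∀ {n} → (Term (suc n) → ℕ) → Term (suc n) → Term n
    restrict e τ = term (weight τ) (e τ) (tail (basis τ))

    tail-combination : ∀ {n t d d′ s S x₀ x} {τs : List (Term (suc n))} (e : Term (suc n) → ℕ) →
      IsCombination t d (s ∷ S) (x₀ ∷ x) τs →
      All (λ τ → Walk 1 (e τ) (toList S) (bits (tail (basis τ))) 0) τs →
      ℕ→ℚ d′ ≡ ℕ→ℚ t * (Σℚ[ τ ∈ τs ] weight τ * ℕ→ℚ (e τ)) →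
      IsCombination t d′ S x (map (restrict e) τs)
    tail-combination {t = t} {τs = τs} e c hs d′≡ = record
      { walks   = All.map⁺ hs
      ; nonNeg  = All.map⁺ (nonNeg c)
      ; total   = trans (Σℚ-map (restrict e) τs weight) (total c)
      ; slack≡  = trans d′≡ (cong (ℕ→ℚ t *_) (sym (Σℚ-map (restrict e) τs _)))
      ; lookup≡ = λ i → trans (lookup≡ c (fsuc i)) (cong (ℕ→ℚ t *_) (trans
          (Σℚ-cong τs (λ τ → cong (λ β → weight τ * ℕ→ℚ (bit β)) (lookup-tail (basis τ) i)))
          (sym (Σℚ-map (restrict e) τs _))))
      }

    Walk-false⁻ : ∀ {n e} {S : Vec Bool n} (B : Vec Bool (suc n)) → Walk 1 e (toList (false ∷ S)) (bits B) 0 →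
      Walk 1 (e ℕ.+ bit (lookup B fzero)) (toList S) (bits (tail B)) 0
    Walk-false⁻ (_ ∷ _) (_ , h) = h

    Walk-true⁻ : ∀ {n e} {S : Vec Bool n} (B : Vec Bool (suc n)) → Walk 1 e (toList (true ∷ S)) (bits B) 0 →
      1 ℕ.≤ e ℕ.+ bit (lookup B fzero) × Walk 1 (e ℕ.+ bit (lookup B fzero) ℕ.∸ 1) (toList S) (bits (tail B)) 0
    Walk-true⁻ (_ ∷ _) (_ , 1≤ , h) = 1≤ , h

    -- Every term has slack ≥ 1 at a 1 of S, so the weighted slack is ≥ 1, i.e. d + y₀ ≥ t.
    slack-true : ∀ {n} t d y₀ (τs : List (Term (suc n))) → All (λ τ → 0ℚ ≤ weight τ) τs → Σℚ τs weight ≡ 1ℚ →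
      All (λ τ → 1 ℕ.≤ slack τ ℕ.+ b₀ τ) τs →
      ℕ→ℚ (d ℕ.+ y₀) ≡ ℕ→ℚ t * (Σℚ[ τ ∈ τs ] weight τ * ℕ→ℚ (slack τ ℕ.+ b₀ τ)) →
      t ℕ.≤ d ℕ.+ y₀ × ℕ→ℚ (d ℕ.+ y₀ ℕ.∸ t) ≡ ℕ→ℚ t * (Σℚ[ τ ∈ τs ] weight τ * ℕ→ℚ (slack τ ℕ.+ b₀ τ ℕ.∸ 1))
    slack-true t d y₀ τs 0≤ total 1≤ d+y₀≡ = t≤ , (begin
      ℕ→ℚ (d ℕ.+ y₀ ℕ.∸ t)                 ≡⟨ ℕ→ℚ-∸ t≤ ⟩
      ℕ→ℚ (d ℕ.+ y₀) - ℕ→ℚ t               ≡⟨ cong₂ _-_ d+y₀≡ (sym (*-identityʳ (ℕ→ℚ t))) ⟩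
      ℕ→ℚ t * P - ℕ→ℚ t * 1ℚ               ≡⟨ distrib (ℕ→ℚ t) P 1ℚ ⟩
      ℕ→ℚ t * (P - 1ℚ)                     ≡⟨ cong (λ q → ℕ→ℚ t * (P - q)) total ⟨
      ℕ→ℚ t * (P - Σℚ τs weight)           ≡⟨ cong (λ q → ℕ→ℚ t * (P + q)) (Σℚ-neg τs weight) ⟨
      ℕ→ℚ t * (P + (Σℚ[ τ ∈ τs ] - weight τ)) ≡⟨ cong (ℕ→ℚ t *_) (Σℚ-distrib-+ τs _ _) ⟨
      ℕ→ℚ t * (Σℚ[ τ ∈ τs ] weight τ * ℕ→ℚ (slack τ ℕ.+ b₀ τ) - weight τ)
        ≡⟨ cong (ℕ→ℚ t *_) (Σℚ-cong-local (All.map (λ {τ} 1≤e → trans (cong (λ q → weight τ * ℕ→ℚ (slack τ ℕ.+ b₀ τ) - q) (sym (*-identityʳ (weight τ))))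
             (trans (distrib (weight τ) _ 1ℚ) (cong (weight τ *_) (sym (ℕ→ℚ-∸ 1≤e))))) 1≤)) ⟩
      ℕ→ℚ t * (Σℚ[ τ ∈ τs ] weight τ * ℕ→ℚ (slack τ ℕ.+ b₀ τ ℕ.∸ 1)) ∎)
      where
      P : ℚ
      P = Σℚ[ τ ∈ τs ] weight τ * ℕ→ℚ (slack τ ℕ.+ b₀ τ)
      distrib : ∀ a p q → a * p - a * q ≡ a * (p - q)
      distrib = ℚ-Solver.solve-∀ ℚ-ring
      1≤P : 1ℚ ≤ P
      1≤P = ≤-trans (≤-reflexive (sym total)) (Σℚ-mono (All.zipWith (λ {τ} (0≤w , 1≤e) →
              ≤-trans (≤-reflexive (sym (*-identityʳ (weight τ)))) (*-monoˡ-≤-0≤ (weight τ) 0≤w (ℤ→ℚ-mono-≤ (ℤ.+≤+ 1≤e))))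
              (0≤ , 1≤)))
      t≤ : t ℕ.≤ d ℕ.+ y₀
      t≤ = ℕ→ℚ-cancel-≤ (≤-trans (≤-reflexive (sym (*-identityʳ (ℕ→ℚ t))))
             (≤-trans (*-monoˡ-≤-0≤ (ℕ→ℚ t) (ℕ→ℚ-nonNeg t) 1≤P) (≤-reflexive (sym d+y₀≡))))
      open ≡-Reasoning

  -- Along S, the slack of x stays t times the weighted average of the slacks of the terms.
  IsCombination⇒Walk : ∀ {n} t d (S : Vec Bool n) x (τs : List (Term n)) → IsCombination t d S x τs →
    Σ[ y ∈ Vec ℕ n ] (x ≡ Vec.map +_ y × Walk t d (toList S) (toList y) 0)
  IsCombination⇒Walk t d [] [] τs c =
    [] , refl , ℕ→ℚ-injective (trans (slack≡ c) (trans (cong (ℕ→ℚ t *_) (Σℚ-zero (All.map (λ {τ} → no-slack τ) (walks c)))) (*-zeroʳ (ℕ→ℚ t))))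
    where
    no-slack : ∀ τ → Walk 1 (slack τ) [] (bits (basis τ)) 0 → weight τ * ℕ→ℚ (slack τ) ≡ 0ℚ
    no-slack (term w e []) refl = *-zeroʳ w
  IsCombination⇒Walk t d (false ∷ S) (x₀ ∷ x) τs c =
    let y₀ , x₀≡ , y₀≤t = head-coordinate c
        y , x≡ , h = IsCombination⇒Walk t (d ℕ.+ y₀) S x _
          (tail-combination (λ τ → slack τ ℕ.+ b₀ τ) c (All.map (λ {τ} → Walk-false⁻ (basis τ)) (walks c))
            (head-slack (subst (λ z → IsCombination t d _ (z ∷ x) τs) x₀≡ c)))
    in y₀ ∷ y , cong₂ _∷_ x₀≡ x≡ , y₀≤t , h
  IsCombination⇒Walk t d (true ∷ S) (x₀ ∷ x) τs c =
    let y₀ , x₀≡ , y₀≤t = head-coordinate c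
        t≤ , d′≡ = slack-true t d y₀ τs (nonNeg c) (total c) (All.map (λ {τ} → proj₁ ∘ Walk-true⁻ (basis τ)) (walks c))
          (head-slack (subst (λ z → IsCombination t d _ (z ∷ x) τs) x₀≡ c))
        y , x≡ , h = IsCombination⇒Walk t (d ℕ.+ y₀ ℕ.∸ t) S x _
          (tail-combination (λ τ → slack τ ℕ.+ b₀ τ ℕ.∸ 1) c (All.map (λ {τ} → proj₂ ∘ Walk-true⁻ (basis τ)) (walks c)) d′≡)
    in y₀ ∷ y , cong₂ _∷_ x₀≡ x≡ , y₀≤t , t≤ , h

module LatticePoints where

  open import Defs
  open import Data.Bool using (Bool; true; false; if_then_else_)
  open import Data.Nat as ℕ using (ℕ; zero; suc; _<_)
  import Data.Nat.Properties as ℕ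
  open import Data.Integer as ℤ using (ℤ; +_)
  import Data.Integer.Properties as ℤ
  open import Data.Rational as ℚ using (ℚ; 0ℚ; 1ℚ; _*_)
  open import Data.Rational.Properties using (*-identityʳ; *-zeroʳ; *-zeroˡ; *-comm; *-distribʳ-+)
  open import Data.List using (List; []; _∷_; map; length)
  import Data.List.Properties as List
  open import Data.List.Membership.Propositional using (_∈_)
  open import Data.List.Relation.Unary.Unique.Propositional using (Unique)
  open import Data.List.Membership.Propositional.Properties using (∈-map⁺)
  open import Data.List.Relation.Unary.All as All using (All; []; _∷_)
  import Data.List.Relation.Unary.All.Properties as All
  open import Data.Vec using (Vec; []; _∷_; toList; lookup)
  import Data.Vec as Vec
  import Data.Vec.Properties as Vec
  open import Data.Fin using (Fin)
  import Data.Fin.Subset as Subset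
  open import Data.Product using (_×_; _,_; proj₁; proj₂; Σ-syntax)
  open import Relation.Binary.PropositionalEquality
  import Tactic.RingSolver as ℚ-Solver
  open UniqueLists using (Unique-map⁺-on)
  open Walks using (Walk; Walk-length)
  open BlockEnumeration using (word; walks; blockRHS; Unique-walks; ∈-walks⁻; ∈-walks⁺; length-walks)
  open Bases using (bit; IsSMBasis⇒Walk; Walk⇒IsSMBasis)
  open Decomposition using (decompose; multiplicity)
  open Rationals
  open Convexity using (term; IsCombination⇒Walk)

  private
    if≡*bit : ∀ β w → (if β then w else 0ℚ) ≡ w * ℕ→ℚ (bit β)
    if≡*bit true  w = sym (*-identityʳ w)
    if≡*bit false w = sym (*-zeroʳ w)

  InDilation⇒Walk : ∀ {n} (S : Subset.Subset n) t x → InDilation (IsSMBasis S) t x →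
    Σ[ y ∈ Vec ℕ n ] (x ≡ Vec.map +_ y × Walk t 0 (toList S) (toList y) 0)
  InDilation⇒Walk {n} S t x (cs , bases , nonNeg , total , coords) = IsCombination⇒Walk t 0 S x τs (record
    { walks   = All.map⁺ (All.map (λ {c} → IsSMBasis⇒Walk S (proj₂ c)) bases)
    ; nonNeg  = All.map⁺ nonNeg
    ; total   = trans (Σℚ-map toTerm cs _) total
    ; slack≡  = sym (trans (cong (ℕ→ℚ t *_) (trans (Σℚ-map toTerm cs _) (Σℚ-zero (All.universal (λ c → *-zeroʳ (proj₁ c)) cs))))
                           (*-zeroʳ (ℕ→ℚ t)))
    ; lookup≡ = λ i → trans (coords i) (cong (ℕ→ℚ t *_)
                  (trans (Σℚ-cong cs (λ c → if≡*bit (lookup (proj₂ c) i) (proj₁ c))) (sym (Σℚ-map toTerm cs _))))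
    })
    where
    toTerm : ℚ × Subset.Subset n → Convexity.Term n
    toTerm (w , B) = term w 0 B
    τs : List (Convexity.Term n)
    τs = map toTerm cs

  private
    Σℚ-multiplicity : ∀ {n} q (i : Fin n) Bs → (Σℚ[ B ∈ Bs ] (if lookup B i then q else 0ℚ)) ≡ ℕ→ℚ (multiplicity i Bs) * q
    Σℚ-multiplicity q i []       = sym (*-zeroˡ q)
    Σℚ-multiplicity q i (B ∷ Bs) = begin
      (if lookup B i then q else 0ℚ) ℚ.+ Σℚ-rest                      ≡⟨ cong₂ ℚ._+_ (trans (if≡*bit (lookup B i) q) (*-comm q _)) (Σℚ-multiplicity q i Bs) ⟩
      ℕ→ℚ (bit (lookup B i)) * q ℚ.+ ℕ→ℚ (multiplicity i Bs) * q     ≡⟨ *-distribʳ-+ q (ℕ→ℚ (bit (lookup B i))) (ℕ→ℚ (multiplicity i Bs)) ⟨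
      (ℕ→ℚ (bit (lookup B i)) ℚ.+ ℕ→ℚ (multiplicity i Bs)) * q       ≡⟨ cong (_* q) (ℕ→ℚ-+ (bit (lookup B i)) (multiplicity i Bs)) ⟨
      ℕ→ℚ (multiplicity i (B ∷ Bs)) * q                              ∎
      where
      open ≡-Reasoning
      Σℚ-rest : ℚ
      Σℚ-rest = Σℚ[ B ∈ Bs ] (if lookup B i then q else 0ℚ)

  private
    average-total : ∀ {n} t (Bs : List (Vec Bool n)) → length Bs ≡ suc t → Σℚ (map (1/[1+ t ] ,_) Bs) proj₁ ≡ 1ℚ
    average-total t Bs len = begin
      Σℚ (map (1/[1+ t ] ,_) Bs) proj₁     ≡⟨ Σℚ-map (1/[1+ t ] ,_) Bs proj₁ ⟩
      (Σℚ[ B ∈ Bs ] 1/[1+ t ])             ≡⟨ Σℚ-const Bs 1/[1+ t ] ⟩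
      ℕ→ℚ (length Bs) * 1/[1+ t ]          ≡⟨ cong (λ k → ℕ→ℚ k * 1/[1+ t ]) len ⟩
      ℕ→ℚ (suc t) * 1/[1+ t ]              ≡⟨ [1+t]*1/[1+t] t ⟩
      1ℚ                                   ∎
      where open ≡-Reasoning

    average-lookup : ∀ {n} t (Bs : List (Vec Bool n)) (y : Vec ℕ n) → (∀ i → lookup y i ≡ multiplicity i Bs) → ∀ i →
      ℤ→ℚ (lookup (Vec.map +_ y) i) ≡ ℕ→ℚ (suc t) * Σℚ (map (1/[1+ t ] ,_) Bs) (λ c → if lookup (proj₂ c) i then proj₁ c else 0ℚ)
    average-lookup t Bs y y≡ i = sym (begin
      ℕ→ℚ (suc t) * Σℚ (map (1/[1+ t ] ,_) Bs) (λ c → if lookup (proj₂ c) i then proj₁ c else 0ℚ)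
        ≡⟨ cong (ℕ→ℚ (suc t) *_) (Σℚ-map (1/[1+ t ] ,_) Bs (λ c → if lookup (proj₂ c) i then proj₁ c else 0ℚ)) ⟩
      ℕ→ℚ (suc t) * (Σℚ[ B ∈ Bs ] (if lookup B i then 1/[1+ t ] else 0ℚ))
        ≡⟨ cong (ℕ→ℚ (suc t) *_) (Σℚ-multiplicity 1/[1+ t ] i Bs) ⟩
      ℕ→ℚ (suc t) * (ℕ→ℚ (multiplicity i Bs) * 1/[1+ t ])
        ≡⟨ swap (ℕ→ℚ (suc t)) (ℕ→ℚ (multiplicity i Bs)) 1/[1+ t ] ⟩
      ℕ→ℚ (multiplicity i Bs) * (ℕ→ℚ (suc t) * 1/[1+ t ])
        ≡⟨ cong (ℕ→ℚ (multiplicity i Bs) *_) ([1+t]*1/[1+t] t) ⟩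
      ℕ→ℚ (multiplicity i Bs) * 1ℚ
        ≡⟨ *-identityʳ _ ⟩
      ℕ→ℚ (multiplicity i Bs)
        ≡⟨ cong ℕ→ℚ (y≡ i) ⟨
      ℕ→ℚ (lookup y i)
        ≡⟨ cong ℤ→ℚ (Vec.lookup-map i +_ y) ⟨
      ℤ→ℚ (lookup (Vec.map +_ y) i)
        ∎)
      where
      open ≡-Reasoning
      swap : ∀ a b c → a * (b * c) ≡ b * (a * c)
      swap = ℚ-Solver.solve-∀ ℚ-ring

  -- A walk with weights ≤ t + 1 is the average of the t + 1 bases it decomposes into.
  Walk⇒InDilation : ∀ {n} (S : Subset.Subset n) t (y : Vec ℕ n) → Walk (suc t) 0 (toList S) (toList y) 0 →
    InDilation (IsSMBasis S) (suc t) (Vec.map +_ y)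
  Walk⇒InDilation S t y h =
    let Bs , len , hs , y≡ = decompose (suc t) S y h
    in map (1/[1+ t ] ,_) Bs ,
       All.map⁺ (All.map (λ {B} → Walk⇒IsSMBasis S B) hs) ,
       All.map⁺ (All.universal (λ _ → 1/[1+]-nonNeg t) Bs) ,
       average-total t Bs len ,
       average-lookup t Bs y y≡

  -- The first n entries of a list.
  toVec : ∀ n → List ℕ → Vec ℕ n
  toVec zero    _        = []
  toVec (suc n) []       = 0 ∷ toVec n []
  toVec (suc n) (y ∷ ys) = y ∷ toVec n ys

  toVec-toList : ∀ {n} (y : Vec ℕ n) → toVec n (toList y) ≡ y
  toVec-toList []       = refl
  toVec-toList (y ∷ ys) = cong (y ∷_) (toVec-toList ys)

  toList-toVec : ∀ n ys → length ys ≡ n → toList (toVec n ys) ≡ ys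
  toList-toVec zero    []       refl = refl
  toList-toVec (suc n) (y ∷ ys) len  = cong (y ∷_) (toList-toVec n ys (ℕ.suc-injective len))

  map-+-injective : ∀ {n} (u v : Vec ℕ n) → Vec.map +_ u ≡ Vec.map +_ v → u ≡ v
  map-+-injective []       []       _  = refl
  map-+-injective (x ∷ u) (y ∷ v) eq =
    cong₂ _∷_ (ℤ.+-injective (Vec.∷-injectiveˡ eq)) (map-+-injective u v (Vec.∷-injectiveʳ eq))

  EhrhartValue-walks : ∀ {n} (S : Subset.Subset n) bs t → toList S ≡ word bs → All (λ block → 0 < proj₂ block) bs →
    EhrhartValue (IsSMBasis S) (suc t) (blockRHS (suc t) bs)
  EhrhartValue-walks {n} S bs t S≡word 0<bs = map toPoint L , unique , sound , complete , count
    where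
    L : List (List ℕ)
    L = walks (suc t) bs
    toPoint : List ℕ → Vec ℤ n
    toPoint ys = Vec.map +_ (toVec n ys)
    Walk-S : ∀ {ys} → ys ∈ L → Walk (suc t) 0 (toList S) ys 0
    Walk-S ys∈ = subst (λ w → Walk (suc t) 0 w _ 0) (sym S≡word) (∈-walks⁻ (suc t) bs ys∈)
    length≡n : ∀ {ys} → ys ∈ L → length ys ≡ n
    length≡n ys∈ = trans (Walk-length _ _ (Walk-S ys∈)) (Vec.length-toList S)
    unique : Unique (map toPoint L)
    unique = Unique-map⁺-on toPoint (Unique-walks (suc t) bs) (λ {u} {v} u∈ v∈ eq →
      trans (sym (toList-toVec n u (length≡n u∈))) (trans (cong toList (map-+-injective _ _ eq)) (toList-toVec n v (length≡n v∈))))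
    sound : All (InDilation (IsSMBasis S) (suc t)) (map toPoint L)
    sound = All.map⁺ (All.tabulate (λ {ys} ys∈ → Walk⇒InDilation S t (toVec n ys)
      (subst (λ zs → Walk (suc t) 0 (toList S) zs 0) (sym (toList-toVec n ys (length≡n ys∈))) (Walk-S ys∈))))
    complete : ∀ x → InDilation (IsSMBasis S) (suc t) x → x ∈ map toPoint L
    complete x x∈ with y , refl , h ← InDilation⇒Walk S (suc t) x x∈ =
      subst (_∈ map toPoint L) (cong (Vec.map +_) (toVec-toList y))
        (∈-map⁺ toPoint (∈-walks⁺ (suc t) bs (subst (λ w → Walk (suc t) 0 w (toList y) 0) S≡word h)))
    count : + length (map toPoint L) ≡ blockRHS (suc t) bs
    count = trans (cong +_ (List.length-map toPoint L)) (length-walks (suc t) bs 0<bs)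

open import Defs
open import Data.Nat using (ℕ; suc; _<_)
open import Data.Fin using (Fin; toℕ; fromℕ)
open import Data.Fin.Subset using (Subset; _∈_)
open import Data.Vec using (toList)
open import Relation.Binary.PropositionalEquality using (_≡_; subst; sym; trans)
open import Data.List using (allFin)
import Data.List.Relation.Unary.All as All
import Data.List.Relation.Unary.All.Properties as All
open RunBlocks using (blocksOf; word-blocksOf; RHS≡blockRHS)
open LatticePoints using (EhrhartValue-walks)

-- The hypotheses n ∈ S and a_i > 0 for i ≥ 2 only make the run decomposition of S unique;
-- the count holds for any decomposition with positive b_i.
theorem1p1 : (k : ℕ) (S : Subset (suc k)) → fromℕ k ∈ S →
    (m : ℕ) (a b : Fin m → ℕ) →
    (∀ i → 0 < b i) → (∀ i → 0 < toℕ i → 0 < a i) →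
    toList S ≡ runWord a b →
    (t : ℕ) → 0 < t →
    EhrhartValue (IsSMBasis S) t (RHS a b t)
theorem1p1 k S _ m a b 0<b _ S≡runWord (suc t) _ =
  subst (EhrhartValue (IsSMBasis S) (suc t)) (sym (RHS≡blockRHS (suc t) a b))
    (EhrhartValue-walks S (blocksOf a b) t (trans S≡runWord (word-blocksOf a b)) (All.map⁺ (All.universal 0<b (allFin m))))
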